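{- Let $m\ge 6$ with $m\equiv 2\pmod 4$. Then: 1. the graphs $B_2(m;2,2,\frac m2)$ and $B_1(m;2,2)$ are both isomorphic to $\mathrm{Circ}(2m,\{4,\frac m2\})$, and this graph is a nut graph; 2. the graphs $B_2(m;1,1,\frac m2)$ and $B_3(m;1,m-1)$ are both isomorphic to $\mathrm{Circ}(2m,\{2,\frac m2\})$, and this graph is a nut graph.
   Context: A graph is a nut graph if $0$ is an adjacency eigenvalue of multiplicity one and a corresponding eigenvector has no zero entries. All graphs below have vertices $x_0,\dots,x_{m-1},y_0,\dots,y_{m-1}$ with indices mod $m$. $B_1(m;a,b)$ has edges $x_ix_{i\pm a}$, $x_ix_{i+m/2}$, $y_iy_{i\pm b}$, $y_iy_{i+m/2}$, $x_iy_i$; $B_2(m;a,b,c)$ has edges $x_ix_{i\pm a}$, $y_iy_{i\pm b}$, $x_iy_i$, $x_iy_{i+c}$; $B_3(m;a,b)$ has edges $x_ix_{i+m/2}$, $y_iy_{i+m/2}$, $x_iy_i$, $x_iy_{i+a}$, $x_iy_{i+b}$ (all for every $i$). The circulant graph $\mathrm{Circ}(n,S)$ has vertex set $\mathbb{Z}_n$, with $i\sim j$ iff $i-j\in S\cup(-S)$. -}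

module Defs where

open import Data.Nat using (ℕ; zero; suc; _+_; ∣_-_∣)
open import Data.Nat.DivMod using (_/_)
open import Data.Nat.Divisibility using (_∣?_)
open import Data.Fin using (Fin; toℕ; splitAt; zero; suc)
open import Data.Sum using (_⊎_; inj₁; inj₂)
open import Data.Product using (Σ; ∃; _×_)
open import Data.Bool using (Bool; true; false; _∨_; if_then_else_)
open import Data.List using (List)
open import Data.Bool.ListAction using (any)
open import Relation.Nullary using (¬_)
open import Relation.Nullary.Decidable using (⌊_⌋)
open import Data.Rational using (ℚ; 0ℚ; 1ℚ) renaming (_+_ to _+ℚ_; _*_ to _*ℚ_)
open import Function.Bundles using (_⤖_; Bijection)
open import Relation.Binary.PropositionalEquality using (_≡_)

congB : ℕ → ℕ → ℕ → Bool
congB m a b = ⌊ m ∣? ∣ a - b ∣ ⌋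

diffB : ℕ → ℕ → ℕ → ℕ → Bool
diffB m s i j = congB m (i + s) j ∨ congB m (j + s) i

record Graph (n : ℕ) : Set where
  field
    adj : Fin n → Fin n → Bool
open Graph public

-- Vertices of the B-graphs: Fin (m + m); the first m are x_0..x_{m-1}, the last m are y_0..y_{m-1}.
-- Generic two-layer adjacency: xx-rule, yy-rule, and x_i ~ y_j rule (all on indices in ℕ).
twoLayer : (m : ℕ) → (ℕ → ℕ → Bool) → (ℕ → ℕ → Bool) → (ℕ → ℕ → Bool) →
           Fin m ⊎ Fin m → Fin m ⊎ Fin m → Bool
twoLayer m xx yy xy (inj₁ i) (inj₁ j) = xx (toℕ i) (toℕ j)
twoLayer m xx yy xy (inj₂ i) (inj₂ j) = yy (toℕ i) (toℕ j)
twoLayer m xx yy xy (inj₁ i) (inj₂ j) = xy (toℕ i) (toℕ j)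
twoLayer m xx yy xy (inj₂ j) (inj₁ i) = xy (toℕ i) (toℕ j)

mkTwoLayer : (m : ℕ) → (ℕ → ℕ → Bool) → (ℕ → ℕ → Bool) → (ℕ → ℕ → Bool) → Graph (m + m)
mkTwoLayer m xx yy xy = record { adj = λ u v → twoLayer m xx yy xy (splitAt m u) (splitAt m v) }

B₁ : (m a b : ℕ) → Graph (m + m)
B₁ m a b = mkTwoLayer m
  (λ i j → diffB m a i j ∨ diffB m (m / 2) i j)
  (λ i j → diffB m b i j ∨ diffB m (m / 2) i j)
  (λ i j → congB m i j)

B₂ : (m a b c : ℕ) → Graph (m + m)
B₂ m a b c = mkTwoLayer m
  (λ i j → diffB m a i j)
  (λ i j → diffB m b i j)
  (λ i j → congB m i j ∨ congB m (i + c) j)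

B₃ : (m a b : ℕ) → Graph (m + m)
B₃ m a b = mkTwoLayer m
  (λ i j → diffB m (m / 2) i j)
  (λ i j → diffB m (m / 2) i j)
  (λ i j → congB m i j ∨ congB m (i + a) j ∨ congB m (i + b) j)

Circ : (n : ℕ) → List ℕ → Graph n
Circ n S = record { adj = λ u v → any (λ s → diffB n s (toℕ u) (toℕ v)) S }

record _≅_ {n n' : ℕ} (G : Graph n) (H : Graph n') : Set where
  field
    bij      : Fin n ⤖ Fin n'
    preserve : ∀ u v → adj G u v ≡ adj H (Bijection.to bij u) (Bijection.to bij v)

∑ : ∀ {n} → (Fin n → ℚ) → ℚ
∑ {zero}  f = 0ℚ
∑ {suc n} f = f zero +ℚ ∑ (λ i → f (suc i))

adjMat : ∀ {n} → Graph n → Fin n → Fin n → ℚ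
adjMat G u v = if adj G u v then 1ℚ else 0ℚ

InKernel : ∀ {n} → Graph n → (Fin n → ℚ) → Set
InKernel G x = ∀ u → ∑ (λ v → adjMat G u v *ℚ x v) ≡ 0ℚ

-- Nut graph: 0 is an eigenvalue of multiplicity one (the kernel is spanned by a single
-- vector x) and that eigenvector has no zero entries.
IsNut : ∀ {n} → Graph n → Set
IsNut {n} G = Σ (Fin n → ℚ) λ x →
  InKernel G x ×
  (∀ u → ¬ (x u ≡ 0ℚ)) ×
  (∀ y → InKernel G y → ∃ λ c → ∀ u → y u ≡ c *ℚ x u)

-- Write m = 2k with k odd and n = 4k. As k is odd, (i , c) ↦ 2i + ck is a bijection ℤ_m × ℤ_2 → ℤ_n under
-- which a jump by 2h in Circ(n, {2h, k}) keeps c and moves i by h, while a jump by k flips c and moves i by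
-- 0 or k. Hence x_i ↦ 2i, y_i ↦ 2i + k is an isomorphism B₂(m; h, h, k) ≅ Circ(n, {2h, k}). Exchanging x_i
-- and y_i for odd i turns B₁(m; a, a) with a even and B₃(m; d, m − d) with d odd into B₂(m; a, a, k) and
-- B₂(m; d, d, k).
--
-- In Circ(n, {s, k}) with s even every vertex has two neighbours of each parity, so (−1)^v is in the
-- kernel. Conversely let Y be n-periodic with Y(v + s) + Y(v − s) + Y(v + k) + Y(v − k) = 0. Then
-- Y(v) − Y(v + m) changes sign under v ↦ v + 2s, and an odd multiple of 2s is a multiple of n, so it
-- vanishes; an analogous argument for the k-periodic Y(v) + Y(v + k) gives Y(v + k) = −Y(v). The equation
-- then says that Y is affine along steps of s, hence s-periodic, and as gcd(s, m) = 2 it is 2-periodic.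
-- So Y(v + 1) = Y(v + k) = −Y(v).

module Submission where

open import Defs
open import Data.Nat.Base as ℕ using (ℕ; NonZero; _<_; parity)
open import Data.Nat.GCD using (GCD)
open import Data.Parity.Base using (1ℙ)
open import Relation.Binary.PropositionalEquality using (_≡_)

module Congruence where

  open import Data.Fin.Base using (toℕ)
  open import Data.Fin.Properties using (toℕ-fromℕ<)
  open import Data.Nat.Base using (_+_; _*_; _∸_; _≤_; ∣_-_∣; >-nonZero; z≤n)
  open import Data.Nat.Properties using (_≟_; +-assoc; +-comm; +-cancelˡ-≡; ≤-total; ≤-<-trans; m+[n∸m]≡n;
    m≤n⇒∣m-n∣≡n∸m; ∣-∣-comm; ∣m+n-m+o∣≡∣n-o∣; *-distribˡ-∣-∣; +-commutativeSemigroup)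
  open import Data.Nat.DivMod using (_%_; _/_; _mod_; m≡m%n+[m/n]*n; %-remove-+ʳ; %-distribˡ-+; m%n%n≡m%n;
    [m+n]%n≡m%n; m<n⇒m%n≡m; m%n<n)
  open import Data.Nat.Divisibility using (_∣_; _∣?_; ∣m+n∣m⇒∣n; n∣m*n; *-cancelˡ-∣; *-monoʳ-∣)
  open import Algebra.Properties.CommutativeSemigroup +-commutativeSemigroup using (xy∙z≈xz∙y)
  open import Data.Parity.Base as ℙ using (0ℙ)
  import Data.Parity.Properties as ℙ
  open import Data.Bool.Base using (true; false; _∨_)
  open import Data.Bool.Properties using (¬-not)
  open import Data.Sum.Base using (inj₁; inj₂)
  open import Function.Bundles using (_⇔_; mk⇔; module Equivalence)
  open import Relation.Nullary.Decidable using (Dec; yes; no; ⌊_⌋; does-⇔; isYes≗does)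
  open import Relation.Nullary.Negation using (contradiction)
  open import Relation.Binary.PropositionalEquality
  open ≡-Reasoning

  ∣⇔%≡%+ : ∀ N .{{_ : NonZero N}} a d → N ∣ d ⇔ a % N ≡ (a + d) % N
  ∣⇔%≡%+ N a d = mk⇔ (λ N∣d → sym (%-remove-+ʳ a N∣d)) (λ a≡a+d →
    ∣m+n∣m⇒∣n (subst (N ∣_) (sym (cancelled a≡a+d)) (n∣m*n ((a + d) / N))) (n∣m*n (a / N)))
    where
    cancelled : a % N ≡ (a + d) % N → a / N * N + d ≡ (a + d) / N * N
    cancelled a≡a+d = +-cancelˡ-≡ (a % N) _ _ (begin
      a % N + (a / N * N + d)        ≡⟨ +-assoc (a % N) _ d ⟨
      a % N + a / N * N + d          ≡⟨ cong (_+ d) (m≡m%n+[m/n]*n a N) ⟨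
      a + d                          ≡⟨ m≡m%n+[m/n]*n (a + d) N ⟩
      (a + d) % N + (a + d) / N * N  ≡⟨ cong (_+ (a + d) / N * N) a≡a+d ⟨
      a % N + (a + d) / N * N        ∎)

  ≤⇒∣∣-∣⇔%≡% : ∀ N .{{_ : NonZero N}} {a b} → a ≤ b → N ∣ ∣ a - b ∣ ⇔ a % N ≡ b % N
  ≤⇒∣∣-∣⇔%≡% N {a} {b} a≤b rewrite m≤n⇒∣m-n∣≡n∸m a≤b =
    subst (λ x → N ∣ b ∸ a ⇔ a % N ≡ x % N) (m+[n∸m]≡n a≤b) (∣⇔%≡%+ N a (b ∸ a))

  ∣∣-∣⇔%≡% : ∀ N .{{_ : NonZero N}} a b → N ∣ ∣ a - b ∣ ⇔ a % N ≡ b % N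
  ∣∣-∣⇔%≡% N a b with ≤-total a b
  ... | inj₁ a≤b = ≤⇒∣∣-∣⇔%≡% N a≤b
  ... | inj₂ b≤a = mk⇔ (λ N∣ → sym (to (subst (N ∣_) (∣-∣-comm a b) N∣)))
                       (λ eq → subst (N ∣_) (∣-∣-comm b a) (from (sym eq)))
    where open Equivalence (≤⇒∣∣-∣⇔%≡% N b≤a)

  ⌊⌋-⇔ : ∀ {A B : Set} → A ⇔ B → (a? : Dec A) (b? : Dec B) → ⌊ a? ⌋ ≡ ⌊ b? ⌋
  ⌊⌋-⇔ A⇔B a? b? = trans (isYes≗does a?) (trans (does-⇔ A⇔B a? b?) (sym (isYes≗does b?)))

  congB≡⌊%≟%⌋ : ∀ N .{{_ : NonZero N}} a b → congB N a b ≡ ⌊ a % N ≟ b % N ⌋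
  congB≡⌊%≟%⌋ N a b = ⌊⌋-⇔ (∣∣-∣⇔%≡% N a b) (N ∣? ∣ a - b ∣) (a % N ≟ b % N)

  congB≡true⇔ : ∀ N .{{_ : NonZero N}} a b → congB N a b ≡ true ⇔ a % N ≡ b % N
  congB≡true⇔ N a b rewrite congB≡⌊%≟%⌋ N a b with a % N ≟ b % N
  ... | yes eq = mk⇔ (λ _ → eq) (λ _ → refl)
  ... | no ¬eq = mk⇔ (λ ()) (λ eq → contradiction eq ¬eq)

  congB-cong : ∀ N .{{_ : NonZero N}} {a a' b b'} → a % N ≡ a' % N → b % N ≡ b' % N →
               congB N a b ≡ congB N a' b'
  congB-cong N {a} {a'} {b} {b'} a≡a' b≡b' = begin
    congB N a b            ≡⟨ congB≡⌊%≟%⌋ N a b ⟩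
    ⌊ a % N ≟ b % N ⌋      ≡⟨ cong₂ (λ x y → ⌊ x ≟ y ⌋) a≡a' b≡b' ⟩
    ⌊ a' % N ≟ b' % N ⌋    ≡⟨ congB≡⌊%≟%⌋ N a' b' ⟨
    congB N a' b'          ∎

  congB⇒≡ : ∀ {N a b} → a < N → b < N → congB N a b ≡ true → a ≡ b
  congB⇒≡ {N} {a} {b} a<N b<N eq = begin
    a      ≡⟨ m<n⇒m%n≡m a<N ⟨
    a % N  ≡⟨ Equivalence.to (congB≡true⇔ N a b) eq ⟩
    b % N  ≡⟨ m<n⇒m%n≡m b<N ⟩
    b      ∎
    where
    instance
      N-nonZero : NonZero N
      N-nonZero = >-nonZero (≤-<-trans z≤n a<N)

  congB-sym : ∀ N a b → congB N a b ≡ congB N b a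
  congB-sym N a b = cong (λ x → ⌊ N ∣? x ⌋) (∣-∣-comm a b)

  congB-+ˡ : ∀ N c a b → congB N (c + a) (c + b) ≡ congB N a b
  congB-+ˡ N c a b = cong (λ x → ⌊ N ∣? x ⌋) (∣m+n-m+o∣≡∣n-o∣ c a b)

  congB-+ʳ : ∀ N c a b → congB N (a + c) (b + c) ≡ congB N a b
  congB-+ʳ N c a b = trans (cong₂ (congB N) (+-comm a c) (+-comm b c)) (congB-+ˡ N c a b)

  congB-swap : ∀ N .{{_ : NonZero N}} {d e} → d + e ≡ N → ∀ a b → congB N (a + e) b ≡ congB N (b + d) a
  congB-swap N {d} {e} d+e≡N a b = begin
    congB N (a + e) b            ≡⟨ congB-+ʳ N d (a + e) b ⟨
    congB N (a + e + d) (b + d)  ≡⟨ cong (λ x → congB N x (b + d)) a+e+d≡a+N ⟩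
    congB N (a + N) (b + d)      ≡⟨ congB-cong N ([m+n]%n≡m%n a N) refl ⟩
    congB N a (b + d)            ≡⟨ congB-sym N a (b + d) ⟩
    congB N (b + d) a            ∎
    where
    a+e+d≡a+N : a + e + d ≡ a + N
    a+e+d≡a+N = trans (+-assoc a e d) (cong (a +_) (trans (+-comm e d) d+e≡N))

  congB-*ˡ : ∀ c .{{_ : NonZero c}} M a b → congB (c * M) (c * a) (c * b) ≡ congB M a b
  congB-*ˡ c M a b = ⌊⌋-⇔ (mk⇔ (λ cM∣ → *-cancelˡ-∣ c (subst (c * M ∣_) (sym (*-distribˡ-∣-∣ c a b)) cM∣))
                               (λ M∣ → subst (c * M ∣_) (*-distribˡ-∣-∣ c a b) (*-monoʳ-∣ c M∣)))
                          (c * M ∣? ∣ c * a - c * b ∣) (M ∣? ∣ a - b ∣)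

  %-congˡ-+ : ∀ N .{{_ : NonZero N}} {a a'} s → a % N ≡ a' % N → (a + s) % N ≡ (a' + s) % N
  %-congˡ-+ N {a} {a'} s eq = begin
    (a + s) % N            ≡⟨ %-distribˡ-+ a s N ⟩
    (a % N + s % N) % N    ≡⟨ cong (λ x → (x + s % N) % N) eq ⟩
    (a' % N + s % N) % N   ≡⟨ %-distribˡ-+ a' s N ⟨
    (a' + s) % N           ∎

  diffB-% : ∀ N .{{_ : NonZero N}} s a b → diffB N s (a % N) (b % N) ≡ diffB N s a b
  diffB-% N s a b = cong₂ _∨_ (congB-cong N (%-congˡ-+ N s (m%n%n≡m%n a N)) (m%n%n≡m%n b N))
                              (congB-cong N (%-congˡ-+ N s (m%n%n≡m%n b N)) (m%n%n≡m%n a N))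

  toℕ-mod : ∀ a N .{{_ : NonZero N}} → toℕ (a mod N) ≡ a % N
  toℕ-mod a N = toℕ-fromℕ< (m%n<n a N)

  parity-% : ∀ N .{{_ : NonZero N}} → parity N ≡ 0ℙ → ∀ a → parity (a % N) ≡ parity a
  parity-% N N-even a = sym (begin
    parity a                                ≡⟨ cong parity (m≡m%n+[m/n]*n a N) ⟩
    parity (a % N + a / N * N)              ≡⟨ ℙ.+-homo-+ (a % N) (a / N * N) ⟩
    parity (a % N) ℙ.+ parity (a / N * N)   ≡⟨ cong (parity (a % N) ℙ.+_) multiple-even ⟩
    parity (a % N) ℙ.+ 0ℙ                   ≡⟨ ℙ.+-identityʳ _ ⟩
    parity (a % N)                          ∎)
    where
    multiple-even : parity (a / N * N) ≡ 0ℙ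
    multiple-even = trans (ℙ.*-homo-* (a / N) N) (trans (cong (parity (a / N) ℙ.*_) N-even) (ℙ.*-zeroʳ _))

  congB-odd : ∀ N .{{_ : NonZero N}} → parity N ≡ 0ℙ → ∀ a b → parity (a + b) ≡ 1ℙ → congB N a b ≡ false
  congB-odd N N-even a b a+b-odd = ¬-not λ congB≡true → 0ℙ≢1ℙ (begin
    0ℙ                       ≡⟨ ℙ.p+p≡0ℙ (parity a) ⟨
    parity a ℙ.+ parity a    ≡⟨ cong (parity a ℙ.+_) (same-parity congB≡true) ⟩
    parity a ℙ.+ parity b    ≡⟨ ℙ.+-homo-+ a b ⟨
    parity (a + b)           ≡⟨ a+b-odd ⟩
    1ℙ                       ∎)
    where
    0ℙ≢1ℙ : 0ℙ ≢ 1ℙ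
    0ℙ≢1ℙ ()
    same-parity : congB N a b ≡ true → parity a ≡ parity b
    same-parity congB≡true = begin
      parity a        ≡⟨ parity-% N N-even a ⟨
      parity (a % N)  ≡⟨ cong parity (Equivalence.to (congB≡true⇔ N a b) congB≡true) ⟩
      parity (b % N)  ≡⟨ parity-% N N-even b ⟩
      parity b        ∎

  parity-+-+ : ∀ a d b → parity (a + d + b) ≡ parity (a + b) ℙ.+ parity d
  parity-+-+ a d b = trans (cong parity (xy∙z≈xz∙y a d b)) (ℙ.+-homo-+ (a + b) d)

  diffB-odd : ∀ N .{{_ : NonZero N}} → parity N ≡ 0ℙ → ∀ d i j → parity (i + j) ℙ.+ parity d ≡ 1ℙ →
              diffB N d i j ≡ false
  diffB-odd N N-even d i j odd = cong₂ _∨_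
    (congB-odd N N-even (i + d) j (trans (parity-+-+ i d j) odd))
    (congB-odd N N-even (j + d) i
      (trans (parity-+-+ j d i) (subst (λ x → parity x ℙ.+ parity d ≡ 1ℙ) (+-comm i j) odd)))

module GraphIsomorphism where

  open import Data.Nat.Base using (suc)
  open import Data.Nat.Properties using (1+n≰n)
  open import Data.Fin.Base using (Fin; punchOut)
  open import Data.Fin.Properties using (_≟_; any?; punchOut-injective; injective⇒≤)
  open import Data.Product.Base using (_,_)
  open import Function.Bundles using (mk⤖)
  open import Function.Definitions using (Injective; StrictlySurjective)
  open import Function.Consequences.Propositional using (strictlySurjective⇒surjective)
  open import Relation.Nullary.Decidable using (yes; no)
  open import Relation.Nullary.Negation using (contradiction)
  open import Relation.Binary.PropositionalEquality

  injective⇒strictlySurjective : ∀ {N} (f : Fin N → Fin N) → Injective _≡_ _≡_ f → StrictlySurjective _≡_ f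
  injective⇒strictlySurjective {N} f f-inj y with any? (λ x → f x ≟ y)
  ... | yes preimage = preimage
  injective⇒strictlySurjective {suc N} f f-inj y | no ∄x =
    contradiction (injective⇒≤ {f = f-without-y} f-without-y-injective) 1+n≰n
    where
    f-without-y : Fin (suc N) → Fin N
    f-without-y x = punchOut {i = y} {j = f x} (λ y≡fx → ∄x (x , sym y≡fx))
    f-without-y-injective : Injective _≡_ _≡_ f-without-y
    f-without-y-injective eq = f-inj (punchOut-injective (λ e → ∄x (_ , sym e)) (λ e → ∄x (_ , sym e)) eq)

  ≅-byInjection : ∀ {N N'} {G : Graph N} {H : Graph N'} → N ≡ N' → (f : Fin N → Fin N') →
                  Injective _≡_ _≡_ f → (∀ u v → adj G u v ≡ adj H (f u) (f v)) → G ≅ H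
  ≅-byInjection refl f f-inj preserves = record
    { bij      = mk⤖ (f-inj , strictlySurjective⇒surjective (injective⇒strictlySurjective f f-inj))
    ; preserve = preserves
    }

module TwoLayerGraph where

  open import Data.Nat.Base using (_+_)
  open import Data.Fin.Base using (Fin; toℕ)
  open import Data.Fin.Properties using (toℕ<n; toℕ-injective)
  open import Data.Parity.Base as ℙ using (Parity; 0ℙ)
  import Data.Parity.Properties as ℙ
  open import Algebra.Properties.CommutativeSemigroup ℙ.+-commutativeSemigroup using (interchange)
  open import Data.Bool.Base using (Bool)
  open import Data.Sum.Base using (_⊎_; inj₁; inj₂)
  open import Data.Product.Base using (_×_; proj₁; proj₂)
  open import Relation.Binary.PropositionalEquality
  open ≡-Reasoning

  byParity : {A : Set} → A → A → Parity → A
  byParity x y 0ℙ = x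
  byParity x y 1ℙ = y

  side : ∀ {M} → Fin M ⊎ Fin M → Parity
  side (inj₁ _) = 0ℙ
  side (inj₂ _) = 1ℙ

  index : ∀ {M} → Fin M ⊎ Fin M → ℕ
  index (inj₁ i) = toℕ i
  index (inj₂ i) = toℕ i

  index< : ∀ {M} (p : Fin M ⊎ Fin M) → index p < M
  index< (inj₁ i) = toℕ<n i
  index< (inj₂ i) = toℕ<n i

  index-side-injective : ∀ {M} {p q : Fin M ⊎ Fin M} → index p ≡ index q → side p ≡ side q → p ≡ q
  index-side-injective {p = inj₁ i} {inj₁ j} i≡j _ = cong inj₁ (toℕ-injective i≡j)
  index-side-injective {p = inj₂ i} {inj₂ j} i≡j _ = cong inj₂ (toℕ-injective i≡j)
  index-side-injective {p = inj₁ i} {inj₂ j} _ ()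
  index-side-injective {p = inj₂ i} {inj₁ j} _ ()

  twoLayer-byParity : ∀ M (same xy : ℕ → ℕ → Bool) → (∀ i j → xy i j ≡ xy j i) → ∀ p q →
    twoLayer M same same xy p q ≡ byParity (same (index p) (index q)) (xy (index p) (index q)) (side p ℙ.+ side q)
  twoLayer-byParity M same xy xy-sym (inj₁ i) (inj₁ j) = refl
  twoLayer-byParity M same xy xy-sym (inj₁ i) (inj₂ j) = refl
  twoLayer-byParity M same xy xy-sym (inj₂ i) (inj₁ j) = xy-sym (toℕ j) (toℕ i)
  twoLayer-byParity M same xy xy-sym (inj₂ i) (inj₂ j) = refl

  byParity-twist : ∀ {A : Set} {x y x' y' : A} δ ε →
    (ε ≡ 0ℙ → x ≡ x' × y ≡ y') → (ε ≡ 1ℙ → x ≡ y' × y ≡ x') → byParity x y δ ≡ byParity x' y' (δ ℙ.+ ε)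
  byParity-twist 0ℙ 0ℙ even odd = proj₁ (even refl)
  byParity-twist 1ℙ 0ℙ even odd = proj₂ (even refl)
  byParity-twist 0ℙ 1ℙ even odd = proj₁ (odd refl)
  byParity-twist 1ℙ 1ℙ even odd = proj₂ (odd refl)

  byParity-twisted : ∀ {X Y X' Y' : ℕ → ℕ → Bool} →
    (∀ i j → parity (i + j) ≡ 0ℙ → X i j ≡ X' i j × Y i j ≡ Y' i j) →
    (∀ i j → parity (i + j) ≡ 1ℙ → X i j ≡ Y' i j × Y i j ≡ X' i j) →
    ∀ i j c c' → byParity (X i j) (Y i j) (c ℙ.+ c') ≡
                 byParity (X' i j) (Y' i j) ((parity i ℙ.+ c) ℙ.+ (parity j ℙ.+ c'))
  byParity-twisted even odd i j c c' =
    trans (byParity-twist (c ℙ.+ c') (parity (i + j)) (even i j) (odd i j)) (cong (byParity _ _) regroup)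
    where
    regroup : (c ℙ.+ c') ℙ.+ parity (i + j) ≡ (parity i ℙ.+ c) ℙ.+ (parity j ℙ.+ c')
    regroup = begin
      (c ℙ.+ c') ℙ.+ parity (i + j)            ≡⟨ cong ((c ℙ.+ c') ℙ.+_) (ℙ.+-homo-+ i j) ⟩
      (c ℙ.+ c') ℙ.+ (parity i ℙ.+ parity j)   ≡⟨ ℙ.+-comm (c ℙ.+ c') _ ⟩
      (parity i ℙ.+ parity j) ℙ.+ (c ℙ.+ c')   ≡⟨ interchange (parity i) c (parity j) c' ⟨
      (parity i ℙ.+ c) ℙ.+ (parity j ℙ.+ c')   ∎

module Interleaving (k : ℕ) {{_ : NonZero k}} (k-odd : parity k ≡ 1ℙ) where

  open Congruence
  open GraphIsomorphism
  open TwoLayerGraph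
  open import Data.Nat.Base using (_+_; _*_; >-nonZero; >-nonZero⁻¹)
  open import Data.Nat.Properties using (≤-trans; m≤m+n; m*n≢0; *-distribˡ-+; +-identityʳ; +-comm)
  open import Data.Nat.DivMod using (_/_; _%_; _mod_; m*n/n≡m)
  open import Data.Nat.Tactic.RingSolver using (solve-∀)
  open import Data.Parity.Base as ℙ using (Parity; 0ℙ)
  import Data.Parity.Properties as ℙ
  open import Data.Bool.Base using (Bool; true; false; _∨_)
  open import Data.Bool.Properties using (∨-comm; ∨-identityʳ; ∨-idem)
  open import Data.List.Base using (_∷_; [])
  open import Data.Fin.Base using (Fin; toℕ; splitAt; join)
  open import Data.Fin.Properties using (join-splitAt)
  open import Data.Sum.Base using (_⊎_)
  open import Data.Product.Base using (_×_; _,_; proj₁; proj₂)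
  open import Function.Base using (_∘_)
  open import Function.Bundles using (module Equivalence)
  open import Function.Definitions using (Injective)
  open import Relation.Binary.PropositionalEquality
  open ≡-Reasoning

  m n : ℕ
  m = k + k
  n = 2 * m

  instance
    m-nonZero : NonZero m
    m-nonZero = >-nonZero (≤-trans (>-nonZero⁻¹ k) (m≤m+n k k))
    n-nonZero : NonZero n
    n-nonZero = m*n≢0 2 m

  m-even : parity m ≡ 0ℙ
  m-even = trans (ℙ.+-homo-+ k k) (ℙ.p+p≡0ℙ (parity k))

  n-even : parity n ≡ 0ℙ
  n-even = ℙ.*-homo-* 2 m

  half : m / 2 ≡ k
  half = trans (cong (_/ 2) (x+x≡x*2 k)) (m*n/n≡m k 2)
    where
    x+x≡x*2 : ∀ x → x + x ≡ x * 2
    x+x≡x*2 = solve-∀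

  interleave : ℕ → Parity → ℕ
  interleave i 0ℙ = 2 * i
  interleave i 1ℙ = 2 * i + k

  parity-interleave : ∀ i c → parity (interleave i c) ≡ c
  parity-interleave i 0ℙ = ℙ.*-homo-* 2 i
  parity-interleave i 1ℙ = trans (ℙ.+-homo-+ (2 * i) k) (cong₂ ℙ._+_ (ℙ.*-homo-* 2 i) k-odd)

  congB-interleave-odd : ∀ i j c c' → c ℙ.+ c' ≡ 1ℙ → congB n (interleave i c) (interleave j c') ≡ false
  congB-interleave-odd i j c c' odd = congB-odd n n-even (interleave i c) (interleave j c') (begin
    parity (interleave i c + interleave j c')
      ≡⟨ ℙ.+-homo-+ (interleave i c) (interleave j c') ⟩
    parity (interleave i c) ℙ.+ parity (interleave j c')
      ≡⟨ cong₂ ℙ._+_ (parity-interleave i c) (parity-interleave j c') ⟩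
    c ℙ.+ c'
      ≡⟨ odd ⟩
    1ℙ ∎)

  congB-interleave : ∀ i j c c' →
    congB n (interleave i c) (interleave j c') ≡ byParity (congB m i j) false (c ℙ.+ c')
  congB-interleave i j 0ℙ 0ℙ = congB-*ˡ 2 m i j
  congB-interleave i j 1ℙ 1ℙ = trans (congB-+ʳ n k (2 * i) (2 * j)) (congB-*ˡ 2 m i j)
  congB-interleave i j 0ℙ 1ℙ = congB-interleave-odd i j 0ℙ 1ℙ refl
  congB-interleave i j 1ℙ 0ℙ = congB-interleave-odd i j 1ℙ 0ℙ refl

  interleave-+2* : ∀ i c h → interleave i c + 2 * h ≡ interleave (i + h) c
  interleave-+2* i 0ℙ h = sym (*-distribˡ-+ 2 i h)
  interleave-+2* i 1ℙ h = 2*i+x+2*h≡2*[i+h]+x i h k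
    where
    2*i+x+2*h≡2*[i+h]+x : ∀ i h x → 2 * i + x + 2 * h ≡ 2 * (i + h) + x
    2*i+x+2*h≡2*[i+h]+x = solve-∀

  carry : ℕ → Parity → ℕ
  carry i 0ℙ = i
  carry i 1ℙ = i + k

  interleave-+k : ∀ i c → interleave i c + k ≡ interleave (carry i c) (1ℙ ℙ.+ c)
  interleave-+k i 0ℙ = refl
  interleave-+k i 1ℙ = 2*i+x+x≡2*[i+x] i k
    where
    2*i+x+x≡2*[i+x] : ∀ i x → 2 * i + x + x ≡ 2 * (i + x)
    2*i+x+x≡2*[i+x] = solve-∀

  diffB-interleave : ∀ s i j c c' i' j' c₁ c₁' →
    interleave i c + s ≡ interleave i' c₁ → interleave j c' + s ≡ interleave j' c₁' →
    diffB n s (interleave i c) (interleave j c') ≡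
      byParity (congB m i' j) false (c₁ ℙ.+ c') ∨ byParity (congB m j' i) false (c₁' ℙ.+ c)
  diffB-interleave s i j c c' i' j' c₁ c₁' i+s j+s = cong₂ _∨_
    (trans (cong (λ x → congB n x (interleave j c')) i+s) (congB-interleave i' j c₁ c'))
    (trans (cong (λ x → congB n x (interleave i c)) j+s) (congB-interleave j' i c₁' c))

  cross : ℕ → ℕ → Bool
  cross i j = congB m i j ∨ congB m (i + k) j

  diffB-interleave-2* : ∀ h i j c c' →
    diffB n (2 * h) (interleave i c) (interleave j c') ≡ byParity (diffB m h i j) false (c ℙ.+ c')
  diffB-interleave-2* h i j c c' =
    trans (diffB-interleave (2 * h) i j c c' (i + h) (j + h) c c' (interleave-+2* i c h) (interleave-+2* j c' h))
          (same-layer c c')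
    where
    same-layer : ∀ c c' → byParity (congB m (i + h) j) false (c ℙ.+ c') ∨
                          byParity (congB m (j + h) i) false (c' ℙ.+ c) ≡
                          byParity (diffB m h i j) false (c ℙ.+ c')
    same-layer 0ℙ 0ℙ = refl
    same-layer 0ℙ 1ℙ = refl
    same-layer 1ℙ 0ℙ = refl
    same-layer 1ℙ 1ℙ = refl

  diffB-interleave-k : ∀ i j c c' →
    diffB n k (interleave i c) (interleave j c') ≡ byParity false (cross i j) (c ℙ.+ c')
  diffB-interleave-k i j c c' =
    trans (diffB-interleave k i j c c' (carry i c) (carry j c') (1ℙ ℙ.+ c) (1ℙ ℙ.+ c')
                            (interleave-+k i c) (interleave-+k j c'))
          (other-layer c c')
    where
    other-layer : ∀ c c' → byParity (congB m (carry i c) j) false ((1ℙ ℙ.+ c) ℙ.+ c') ∨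
                           byParity (congB m (carry j c') i) false ((1ℙ ℙ.+ c') ℙ.+ c) ≡
                           byParity false (cross i j) (c ℙ.+ c')
    other-layer 0ℙ 0ℙ = refl
    other-layer 1ℙ 1ℙ = refl
    other-layer 0ℙ 1ℙ = cong (congB m i j ∨_) (congB-swap m refl j i)
    other-layer 1ℙ 0ℙ =
      trans (∨-comm (congB m (i + k) j) (congB m j i)) (cong (_∨ congB m (i + k) j) (congB-sym m j i))

  vertex : ℕ → Parity → Fin n
  vertex i c = interleave i c mod n

  byParity-∨ : ∀ δ x y → byParity x false δ ∨ (byParity false y δ ∨ false) ≡ byParity x y δ
  byParity-∨ 0ℙ x y = ∨-identityʳ x
  byParity-∨ 1ℙ x y = ∨-identityʳ y

  adj-Circ-vertex : ∀ h i j c c' →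
    adj (Circ n (2 * h ∷ m / 2 ∷ [])) (vertex i c) (vertex j c') ≡ byParity (diffB m h i j) (cross i j) (c ℙ.+ c')
  adj-Circ-vertex h i j c c' = begin
    diffB n (2 * h) (toℕ (vᵢ mod n)) (toℕ (vⱼ mod n)) ∨ (diffB n (m / 2) (toℕ (vᵢ mod n)) (toℕ (vⱼ mod n)) ∨ false)
      ≡⟨ cong₂ (λ x y → diffB n (2 * h) x y ∨ (diffB n (m / 2) x y ∨ false)) (toℕ-mod vᵢ n) (toℕ-mod vⱼ n) ⟩
    diffB n (2 * h) (vᵢ % n) (vⱼ % n) ∨ (diffB n (m / 2) (vᵢ % n) (vⱼ % n) ∨ false)
      ≡⟨ cong₂ (λ x y → x ∨ (y ∨ false)) (diffB-% n (2 * h) vᵢ vⱼ)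
                                         (trans (diffB-% n (m / 2) vᵢ vⱼ) (cong (λ s → diffB n s vᵢ vⱼ) half)) ⟩
    diffB n (2 * h) vᵢ vⱼ ∨ (diffB n k vᵢ vⱼ ∨ false)
      ≡⟨ cong₂ (λ x y → x ∨ (y ∨ false)) (diffB-interleave-2* h i j c c') (diffB-interleave-k i j c c') ⟩
    byParity (diffB m h i j) false (c ℙ.+ c') ∨ (byParity false (cross i j) (c ℙ.+ c') ∨ false)
      ≡⟨ byParity-∨ (c ℙ.+ c') _ _ ⟩
    byParity (diffB m h i j) (cross i j) (c ℙ.+ c') ∎
    where
    vᵢ vⱼ : ℕ
    vᵢ = interleave i c
    vⱼ = interleave j c'

  -- B₁ and B₃ are embedded with t = parity, i.e. with x_i and y_i exchanged for odd i.
  embed : (ℕ → Parity) → Fin m ⊎ Fin m → Fin n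
  embed t p = vertex (index p) (t (index p) ℙ.+ side p)

  byParity-true : ∀ {x} δ → byParity x false δ ≡ true → δ ≡ 0ℙ × x ≡ true
  byParity-true 0ℙ x≡true = refl , x≡true

  embed-injective : ∀ t → Injective _≡_ _≡_ (embed t)
  embed-injective t {p} {q} embed≡ = index-side-injective i≡j side≡
    where
    i j : ℕ
    i = index p
    j = index q
    c c' : Parity
    c = t i ℙ.+ side p
    c' = t j ℙ.+ side q
    same-residue : interleave i c % n ≡ interleave j c' % n
    same-residue = trans (sym (toℕ-mod (interleave i c) n)) (trans (cong toℕ embed≡) (toℕ-mod (interleave j c') n))
    congruent : byParity (congB m i j) false (c ℙ.+ c') ≡ true
    congruent = trans (sym (congB-interleave i j c c')) (Equivalence.from (congB≡true⇔ n _ _) same-residue)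
    i≡j : i ≡ j
    i≡j = congB⇒≡ (index< p) (index< q) (proj₂ (byParity-true (c ℙ.+ c') congruent))
    c≡c' : c ≡ c'
    c≡c' = ℙ.+-cancelʳ-≡ c' c c' (trans (proj₁ (byParity-true (c ℙ.+ c') congruent)) (sym (ℙ.p+p≡0ℙ c')))
    side≡ : side p ≡ side q
    side≡ = ℙ.+-cancelˡ-≡ (t i) (side p) (side q) (trans c≡c' (cong (λ x → t x ℙ.+ side q) (sym i≡j)))

  ≅Circ-byEmbed : ∀ h (t : ℕ → Parity) {G : Graph (m + m)} →
    (∀ u v → adj G u v ≡ adj (Circ n (2 * h ∷ m / 2 ∷ [])) (embed t (splitAt m u)) (embed t (splitAt m v))) →
    G ≅ Circ n (2 * h ∷ m / 2 ∷ [])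
  ≅Circ-byEmbed h t = ≅-byInjection (cong (m +_) (sym (+-identityʳ m))) (embed t ∘ splitAt m) injective
    where
    injective : Injective _≡_ _≡_ (embed t ∘ splitAt m)
    injective {u} {v} eq = begin
      u                        ≡⟨ join-splitAt m m u ⟨
      join m m (splitAt m u)   ≡⟨ cong (join m m) (embed-injective t eq) ⟩
      join m m (splitAt m v)   ≡⟨ join-splitAt m m v ⟩
      v                        ∎

  cross-sym : ∀ i j → cross i j ≡ cross j i
  cross-sym i j = cong₂ _∨_ (congB-sym m i j) (congB-swap m refl i j)

  diffB-k : ∀ i j → diffB m k i j ≡ congB m (i + k) j
  diffB-k i j = trans (cong (congB m (i + k) j ∨_) (congB-swap m refl j i)) (∨-idem _)

  B₂≅Circ : ∀ h → B₂ m h h (m / 2) ≅ Circ n (2 * h ∷ m / 2 ∷ [])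
  B₂≅Circ h = ≅Circ-byEmbed h (λ _ → 0ℙ) λ u v → adjacency (splitAt m u) (splitAt m v)
    where
    cross-half : ℕ → ℕ → Bool
    cross-half i j = congB m i j ∨ congB m (i + m / 2) j
    cross-half≡cross : ∀ i j → cross-half i j ≡ cross i j
    cross-half≡cross i j = cong (λ x → congB m i j ∨ congB m (i + x) j) half
    cross-half-sym : ∀ i j → cross-half i j ≡ cross-half j i
    cross-half-sym i j = trans (cross-half≡cross i j) (trans (cross-sym i j) (sym (cross-half≡cross j i)))
    adjacency : ∀ p q → twoLayer m (diffB m h) (diffB m h) cross-half p q ≡
                        adj (Circ n (2 * h ∷ m / 2 ∷ [])) (embed (λ _ → 0ℙ) p) (embed (λ _ → 0ℙ) q)
    adjacency p q = begin
      twoLayer m (diffB m h) (diffB m h) cross-half p q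
        ≡⟨ twoLayer-byParity m (diffB m h) cross-half cross-half-sym p q ⟩
      byParity (diffB m h i j) (cross-half i j) (side p ℙ.+ side q)
        ≡⟨ cong (λ x → byParity (diffB m h i j) x (side p ℙ.+ side q)) (cross-half≡cross i j) ⟩
      byParity (diffB m h i j) (cross i j) (side p ℙ.+ side q)
        ≡⟨ adj-Circ-vertex h i j (side p) (side q) ⟨
      adj (Circ n (2 * h ∷ m / 2 ∷ [])) (embed (λ _ → 0ℙ) p) (embed (λ _ → 0ℙ) q) ∎
      where
      i j : ℕ
      i = index p
      j = index q

  ≅Circ-twisted : ∀ h (same xy : ℕ → ℕ → Bool) → (∀ i j → xy i j ≡ xy j i) →
    (∀ i j → parity (i + j) ≡ 0ℙ → same i j ≡ diffB m h i j × xy i j ≡ cross i j) →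
    (∀ i j → parity (i + j) ≡ 1ℙ → same i j ≡ cross i j × xy i j ≡ diffB m h i j) →
    mkTwoLayer m same same xy ≅ Circ n (2 * h ∷ m / 2 ∷ [])
  ≅Circ-twisted h same xy xy-sym even odd = ≅Circ-byEmbed h parity λ u v → adjacency (splitAt m u) (splitAt m v)
    where
    adjacency : ∀ p q →
      twoLayer m same same xy p q ≡ adj (Circ n (2 * h ∷ m / 2 ∷ [])) (embed parity p) (embed parity q)
    adjacency p q = begin
      twoLayer m same same xy p q
        ≡⟨ twoLayer-byParity m same xy xy-sym p q ⟩
      byParity (same i j) (xy i j) (side p ℙ.+ side q)
        ≡⟨ byParity-twisted even odd i j (side p) (side q) ⟩
      byParity (diffB m h i j) (cross i j) ((parity i ℙ.+ side p) ℙ.+ (parity j ℙ.+ side q))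
        ≡⟨ adj-Circ-vertex h i j (parity i ℙ.+ side p) (parity j ℙ.+ side q) ⟨
      adj (Circ n (2 * h ∷ m / 2 ∷ [])) (embed parity p) (embed parity q) ∎
      where
      i j : ℕ
      i = index p
      j = index q

  congB-+-odd : ∀ x i j → parity (i + j) ℙ.+ parity x ≡ 1ℙ → congB m (i + x) j ≡ false
  congB-+-odd x i j odd = congB-odd m m-even (i + x) j (trans (parity-+-+ i x j) odd)

  B₁≅Circ : ∀ a → parity a ≡ 0ℙ → B₁ m a a ≅ Circ n (2 * a ∷ m / 2 ∷ [])
  B₁≅Circ a a-even = ≅Circ-twisted a same (congB m) (congB-sym m) even odd
    where
    same : ℕ → ℕ → Bool
    same i j = diffB m a i j ∨ diffB m (m / 2) i j
    same≡ : ∀ i j → same i j ≡ diffB m a i j ∨ diffB m k i j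
    same≡ i j = cong (λ x → diffB m a i j ∨ diffB m x i j) half
    even : ∀ i j → parity (i + j) ≡ 0ℙ → same i j ≡ diffB m a i j × congB m i j ≡ cross i j
    even i j i+j-even = (begin
        same i j                        ≡⟨ same≡ i j ⟩
        diffB m a i j ∨ diffB m k i j   ≡⟨ cong (diffB m a i j ∨_) (diffB-odd m m-even k i j +k-odd) ⟩
        diffB m a i j ∨ false           ≡⟨ ∨-identityʳ _ ⟩
        diffB m a i j                   ∎) ,
      sym (trans (cong (congB m i j ∨_) (congB-+-odd k i j +k-odd)) (∨-identityʳ _))
      where
      +k-odd : parity (i + j) ℙ.+ parity k ≡ 1ℙ
      +k-odd = cong₂ ℙ._+_ i+j-even k-odd
    odd : ∀ i j → parity (i + j) ≡ 1ℙ → same i j ≡ cross i j × congB m i j ≡ diffB m a i j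
    odd i j i+j-odd = (begin
        same i j                        ≡⟨ same≡ i j ⟩
        diffB m a i j ∨ diffB m k i j   ≡⟨ cong₂ _∨_ (diffB-odd m m-even a i j +a-odd) (diffB-k i j) ⟩
        false ∨ congB m (i + k) j       ≡⟨ cong (_∨ congB m (i + k) j) (congB-odd m m-even i j i+j-odd) ⟨
        cross i j                       ∎) ,
      trans (congB-odd m m-even i j i+j-odd) (sym (diffB-odd m m-even a i j +a-odd))
      where
      +a-odd : parity (i + j) ℙ.+ parity a ≡ 1ℙ
      +a-odd = cong₂ ℙ._+_ i+j-odd a-even

  B₃≅Circ : ∀ d e → parity d ≡ 1ℙ → d + e ≡ m → B₃ m d e ≅ Circ n (2 * d ∷ m / 2 ∷ [])
  B₃≅Circ d e d-odd d+e≡m = ≅Circ-twisted d (diffB m (m / 2)) xy xy-sym even odd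
    where
    xy : ℕ → ℕ → Bool
    xy i j = congB m i j ∨ congB m (i + d) j ∨ congB m (i + e) j
    e-odd : parity e ≡ 1ℙ
    e-odd = ℙ.+-cancelˡ-≡ (parity d) (parity e) 1ℙ (begin
      parity d ℙ.+ parity e   ≡⟨ ℙ.+-homo-+ d e ⟨
      parity (d + e)          ≡⟨ cong parity d+e≡m ⟩
      parity m                ≡⟨ m-even ⟩
      0ℙ                      ≡⟨ cong (ℙ._+ 1ℙ) d-odd ⟨
      parity d ℙ.+ 1ℙ         ∎)
    xy-sym : ∀ i j → xy i j ≡ xy j i
    xy-sym i j = cong₂ _∨_ (congB-sym m i j) (begin
      congB m (i + d) j ∨ congB m (i + e) j
        ≡⟨ cong₂ _∨_ (congB-swap m (trans (+-comm e d) d+e≡m) i j) (congB-swap m d+e≡m i j) ⟩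
      congB m (j + e) i ∨ congB m (j + d) i
        ≡⟨ ∨-comm (congB m (j + e) i) (congB m (j + d) i) ⟩
      congB m (j + d) i ∨ congB m (j + e) i ∎)
    diffB-half : ∀ i j → diffB m (m / 2) i j ≡ diffB m k i j
    diffB-half i j = cong (λ x → diffB m x i j) half
    even : ∀ i j → parity (i + j) ≡ 0ℙ → diffB m (m / 2) i j ≡ diffB m d i j × xy i j ≡ cross i j
    even i j i+j-even =
      (begin
        diffB m (m / 2) i j   ≡⟨ diffB-half i j ⟩
        diffB m k i j         ≡⟨ diffB-odd m m-even k i j (+odd k k-odd) ⟩
        false                 ≡⟨ diffB-odd m m-even d i j (+odd d d-odd) ⟨
        diffB m d i j         ∎) ,
      cong (congB m i j ∨_) (begin
        congB m (i + d) j ∨ congB m (i + e) j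
          ≡⟨ cong₂ _∨_ (congB-+-odd d i j (+odd d d-odd)) (congB-+-odd e i j (+odd e e-odd)) ⟩
        false
          ≡⟨ congB-+-odd k i j (+odd k k-odd) ⟨
        congB m (i + k) j ∎)
      where
      +odd : ∀ x → parity x ≡ 1ℙ → parity (i + j) ℙ.+ parity x ≡ 1ℙ
      +odd x = cong₂ ℙ._+_ i+j-even
    odd : ∀ i j → parity (i + j) ≡ 1ℙ → diffB m (m / 2) i j ≡ cross i j × xy i j ≡ diffB m d i j
    odd i j i+j-odd =
      (begin
        diffB m (m / 2) i j         ≡⟨ diffB-half i j ⟩
        diffB m k i j               ≡⟨ diffB-k i j ⟩
        false ∨ congB m (i + k) j   ≡⟨ cong (_∨ congB m (i + k) j) (congB-odd m m-even i j i+j-odd) ⟨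
        cross i j                   ∎) ,
      cong₂ _∨_ (congB-odd m m-even i j i+j-odd) (cong (congB m (i + d) j ∨_) (congB-swap m d+e≡m i j))

module CirculantKernel where

  open Congruence
  open import Data.Nat.Base using (zero; suc; _∸_; _≤_) renaming (_+_ to _+ℕ_)
  open import Data.Nat.Properties using (m∸n+n≡m) renaming (_≟_ to _≟ℕ_)
  open import Data.Nat.DivMod using (_mod_; _%_; m%n%n≡m%n; m<n⇒m%n≡m)
  open import Data.Fin.Base using (Fin; zero; suc; toℕ)
  open import Data.Fin.Properties using (_≟_; toℕ-injective; toℕ<n; suc-injective)
  open import Data.Bool.Base using (true; false; _∨_; if_then_else_)
  open import Data.Bool.Properties using (∨-assoc)
  open import Data.Bool.ListAction using (any)
  open import Data.List.Base using (List; []; _∷_; map; foldr)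
  open import Data.List.Relation.Unary.All using (All; []; _∷_)
  open import Data.List.Relation.Unary.AllPairs using ([]; _∷_)
  open import Data.List.Relation.Unary.Unique.Propositional using (Unique)
  open import Data.Rational.Base using (ℚ; 0ℚ; 1ℚ; _+_; _*_)
  open import Data.Rational.Properties using (+-0-commutativeMonoid; +-identityˡ; +-identityʳ; *-identityˡ; *-zeroˡ)
  open import Algebra.Properties.CommutativeMonoid.Sum +-0-commutativeMonoid
    using (sum; ∑-distrib-+; sum-cong-≗; sum-replicate-zero)
  open import Function.Bundles using (mk⇔; module Equivalence)
  open import Relation.Nullary.Decidable using (yes; no; ⌊_⌋; ⌊⌋-map′)
  open import Relation.Nullary.Negation using (contradiction)
  open import Relation.Binary.PropositionalEquality
  open ≡-Reasoning

  ∑≡sum : ∀ {N} (f : Fin N → ℚ) → ∑ f ≡ sum f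
  ∑≡sum {zero}  f = refl
  ∑≡sum {suc N} f = cong (f zero +_) (∑≡sum (λ w → f (suc w)))

  sum-select : ∀ {N} (y : Fin N → ℚ) p → sum (λ w → if ⌊ w ≟ p ⌋ then y w else 0ℚ) ≡ y p
  sum-select {suc N} y zero = trans (cong (y zero +_) (sum-replicate-zero N)) (+-identityʳ (y zero))
  sum-select {suc N} y (suc p) = begin
    0ℚ + sum (λ w → if ⌊ suc w ≟ suc p ⌋ then y (suc w) else 0ℚ)
      ≡⟨ +-identityˡ _ ⟩
    sum (λ w → if ⌊ suc w ≟ suc p ⌋ then y (suc w) else 0ℚ)
      ≡⟨ sum-cong-≗ (λ w → cong (if_then y (suc w) else 0ℚ) (⌊⌋-map′ (cong suc) suc-injective (w ≟ p))) ⟩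
    sum (λ w → if ⌊ w ≟ p ⌋ then y (suc w) else 0ℚ)
      ≡⟨ sum-select (λ w → y (suc w)) p ⟩
    y (suc p) ∎

  any-≟-∉ : ∀ {N} {p : Fin N} {ps} → All (p ≢_) ps → any (λ q → ⌊ p ≟ q ⌋) ps ≡ false
  any-≟-∉ [] = refl
  any-≟-∉ {p = p} {q ∷ ps} (p≢q ∷ p∉ps) with p ≟ q
  ... | yes p≡q = contradiction p≡q p≢q
  ... | no _ = any-≟-∉ p∉ps

  sum-indicator : ∀ {N} (y : Fin N → ℚ) ps → Unique ps →
    sum (λ w → if any (λ p → ⌊ w ≟ p ⌋) ps then y w else 0ℚ) ≡ foldr _+_ 0ℚ (map y ps)
  sum-indicator {N} y [] [] = sum-replicate-zero N
  sum-indicator y (p ∷ ps) (p∉ps ∷ ps-unique) = begin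
    sum (λ w → if ⌊ w ≟ p ⌋ ∨ any (λ q → ⌊ w ≟ q ⌋) ps then y w else 0ℚ)
      ≡⟨ sum-cong-≗ split ⟩
    sum (λ w → (if ⌊ w ≟ p ⌋ then y w else 0ℚ) + (if any (λ q → ⌊ w ≟ q ⌋) ps then y w else 0ℚ))
      ≡⟨ ∑-distrib-+ (λ w → if ⌊ w ≟ p ⌋ then y w else 0ℚ) (λ w → if any (λ q → ⌊ w ≟ q ⌋) ps then y w else 0ℚ) ⟩
    sum (λ w → if ⌊ w ≟ p ⌋ then y w else 0ℚ) + sum (λ w → if any (λ q → ⌊ w ≟ q ⌋) ps then y w else 0ℚ)
      ≡⟨ cong₂ _+_ (sum-select y p) (sum-indicator y ps ps-unique) ⟩
    y p + foldr _+_ 0ℚ (map y ps) ∎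
    where
    split : ∀ w → (if ⌊ w ≟ p ⌋ ∨ any (λ q → ⌊ w ≟ q ⌋) ps then y w else 0ℚ) ≡
                  (if ⌊ w ≟ p ⌋ then y w else 0ℚ) + (if any (λ q → ⌊ w ≟ q ⌋) ps then y w else 0ℚ)
    split w with w ≟ p
    ... | yes refl = trans (sym (+-identityʳ (y w))) (cong (λ b → y w + (if b then y w else 0ℚ)) (sym (any-≟-∉ p∉ps)))
    ... | no _ = sym (+-identityˡ _)

  module _ {N : ℕ} .{{_ : NonZero N}} where

    infixl 6 _⊕_
    _⊕_ : Fin N → ℕ → Fin N
    u ⊕ o = (toℕ u +ℕ o) mod N

    neighbours : Fin N → List ℕ → List (Fin N)
    neighbours u []      = []
    neighbours u (s ∷ S) = u ⊕ s ∷ u ⊕ (N ∸ s) ∷ neighbours u S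

    congB≡⌊≟mod⌋ : ∀ a (w : Fin N) → congB N a (toℕ w) ≡ ⌊ w ≟ a mod N ⌋
    congB≡⌊≟mod⌋ a w = trans (congB≡⌊%≟%⌋ N a (toℕ w)) (⌊⌋-⇔ (mk⇔ to from) (a % N ≟ℕ toℕ w % N) (w ≟ a mod N))
      where
      to : a % N ≡ toℕ w % N → w ≡ a mod N
      to eq = toℕ-injective (trans (sym (m<n⇒m%n≡m (toℕ<n w))) (trans (sym eq) (sym (toℕ-mod a N))))
      from : w ≡ a mod N → a % N ≡ toℕ w % N
      from refl = sym (trans (m<n⇒m%n≡m (toℕ<n (a mod N))) (toℕ-mod a N))

    adj-Circ : ∀ S → All (_≤ N) S → ∀ u w → adj (Circ N S) u w ≡ any (λ p → ⌊ w ≟ p ⌋) (neighbours u S)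
    adj-Circ [] [] u w = refl
    adj-Circ (s ∷ S) (s≤N ∷ S≤N) u w = begin
      (congB N (toℕ u +ℕ s) (toℕ w) ∨ congB N (toℕ w +ℕ s) (toℕ u)) ∨ adj (Circ N S) u w
        ≡⟨ ∨-assoc (congB N (toℕ u +ℕ s) (toℕ w)) (congB N (toℕ w +ℕ s) (toℕ u)) (adj (Circ N S) u w) ⟩
      congB N (toℕ u +ℕ s) (toℕ w) ∨ (congB N (toℕ w +ℕ s) (toℕ u) ∨ adj (Circ N S) u w)
        ≡⟨ cong₂ _∨_ (congB≡⌊≟mod⌋ (toℕ u +ℕ s) w) (cong₂ _∨_ backward (adj-Circ S S≤N u w)) ⟩
      any (λ p → ⌊ w ≟ p ⌋) (neighbours u (s ∷ S)) ∎
      where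
      backward : congB N (toℕ w +ℕ s) (toℕ u) ≡ ⌊ w ≟ u ⊕ (N ∸ s) ⌋
      backward = trans (congB-swap N (m∸n+n≡m s≤N) (toℕ w) (toℕ u)) (congB≡⌊≟mod⌋ (toℕ u +ℕ (N ∸ s)) w)

    ∑-adjMat-Circ : ∀ S → All (_≤ N) S → ∀ u → Unique (neighbours u S) → ∀ y →
      ∑ (λ w → adjMat (Circ N S) u w * y w) ≡ foldr _+_ 0ℚ (map y (neighbours u S))
    ∑-adjMat-Circ S S≤N u unique y = begin
      ∑ (λ w → adjMat (Circ N S) u w * y w)
        ≡⟨ ∑≡sum (λ w → adjMat (Circ N S) u w * y w) ⟩
      sum (λ w → adjMat (Circ N S) u w * y w)
        ≡⟨ sum-cong-≗ (λ w → trans (indicator-* (adj (Circ N S) u w) (y w))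
                                   (cong (if_then y w else 0ℚ) (adj-Circ S S≤N u w))) ⟩
      sum (λ w → if any (λ p → ⌊ w ≟ p ⌋) (neighbours u S) then y w else 0ℚ)
        ≡⟨ sum-indicator y (neighbours u S) unique ⟩
      foldr _+_ 0ℚ (map y (neighbours u S)) ∎
      where
      indicator-* : ∀ b x → (if b then 1ℚ else 0ℚ) * x ≡ (if b then x else 0ℚ)
      indicator-* true  x = *-identityˡ x
      indicator-* false x = *-zeroˡ x

    mod-⊕ : ∀ v o → v mod N ⊕ o ≡ (v +ℕ o) mod N
    mod-⊕ v o = toℕ-injective (begin
      toℕ ((toℕ (v mod N) +ℕ o) mod N)  ≡⟨ toℕ-mod (toℕ (v mod N) +ℕ o) N ⟩
      (toℕ (v mod N) +ℕ o) % N          ≡⟨ %-congˡ-+ N o (trans (cong (_% N) (toℕ-mod v N)) (m%n%n≡m%n v N)) ⟩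
      (v +ℕ o) % N                      ≡⟨ toℕ-mod (v +ℕ o) N ⟨
      toℕ ((v +ℕ o) mod N)              ∎)

    toℕ-mod-inverse : ∀ (u : Fin N) → toℕ u mod N ≡ u
    toℕ-mod-inverse u = toℕ-injective (trans (toℕ-mod (toℕ u) N) (m<n⇒m%n≡m (toℕ<n u)))

    ⊕-injective : ∀ u {o o'} → o < N → o' < N → u ⊕ o ≡ u ⊕ o' → o ≡ o'
    ⊕-injective u {o} {o'} o<N o'<N eq = congB⇒≡ o<N o'<N (trans (sym (congB-+ˡ N (toℕ u) o o'))
      (Equivalence.from (congB≡true⇔ N (toℕ u +ℕ o) (toℕ u +ℕ o'))
        (trans (sym (toℕ-mod (toℕ u +ℕ o) N)) (trans (cong toℕ eq) (toℕ-mod (toℕ u +ℕ o') N)))))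

module PeriodicFunctions where

  open TwoLayerGraph using (byParity)
  open import Data.Nat.Base using (zero; suc)
  import Data.Nat.Properties as ℕ
  open import Data.Nat.GCD using (module Bézout)
  open import Data.Nat.Tactic.RingSolver using (solve-∀)
  open import Data.Parity.Base as ℙ using (0ℙ)
  import Data.Parity.Properties as ℙ
  open import Data.Rational.Base as ℚ using (ℚ; 0ℚ; 1ℚ; _+_; _-_; -_; _*_; 1/_; NonNegative)
  open import Data.Rational.Properties using (+-0-group; +-*-commutativeRing; _≟_; +-identityʳ; +-inverseˡ;
    neg-distribˡ-*; *-identityˡ; *-zeroʳ; *-assoc; *-inverseˡ; pos+nonNeg⇒pos; nonNeg+nonNeg⇒nonNeg; pos⇒nonZero)
  open import Algebra.Bundles using (CommutativeRing)
  open import Algebra.Properties.Group +-0-group using (x∙y⁻¹≈ε⇒x≈y; ∙-cancelˡ; ⁻¹-involutive)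
  open import Algebra.Properties.Semiring.Mult (CommutativeRing.semiring +-*-commutativeRing) using (_×_; ×-assoc-*)
  import Tactic.RingSolver as RingSolver
  open import Tactic.RingSolver.Core.AlmostCommutativeRing using (AlmostCommutativeRing; fromCommutativeRing)
  open import Level using (0ℓ)
  open import Relation.Nullary.Decidable using (dec⇒maybe)
  open import Relation.Binary.PropositionalEquality
  open ≡-Reasoning

  ℚ-ring : AlmostCommutativeRing 0ℓ 0ℓ
  ℚ-ring = fromCommutativeRing +-*-commutativeRing (λ x → dec⇒maybe (0ℚ ≟ x))

  ×1-nonNegative : ∀ i → NonNegative (i × 1ℚ)
  ×1-nonNegative zero    = _
  ×1-nonNegative (suc i) = nonNeg+nonNeg⇒nonNeg 1ℚ (i × 1ℚ) {{×1-nonNegative i}}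

  ×-cancel : ∀ o .{{_ : NonZero o}} x → o × x ≡ 0ℚ → x ≡ 0ℚ
  ×-cancel (suc i) x o×x≡0 = begin
    x                 ≡⟨ *-identityˡ x ⟨
    1ℚ * x            ≡⟨ cong (_* x) (*-inverseˡ o) ⟨
    (1/ o) * o * x    ≡⟨ *-assoc (1/ o) o x ⟩
    (1/ o) * (o * x)  ≡⟨ cong ((1/ o) *_) o*x≡0 ⟩
    (1/ o) * 0ℚ       ≡⟨ *-zeroʳ (1/ o) ⟩
    0ℚ                ∎
    where
    o : ℚ
    o = suc i × 1ℚ
    instance
      o≢0 : ℚ.NonZero o
      o≢0 = pos⇒nonZero o {{pos+nonNeg⇒pos 1ℚ (i × 1ℚ) {{×1-nonNegative i}}}}
    o*x≡0 : o * x ≡ 0ℚ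
    o*x≡0 = trans (×-assoc-* (suc i) 1ℚ x) (trans (cong (suc i ×_) (*-identityˡ x)) o×x≡0)

  Periodic : ℕ → (ℕ → ℚ) → Set
  Periodic p f = ∀ v → f (v ℕ.+ p) ≡ f v

  Antiperiodic : ℕ → (ℕ → ℚ) → Set
  Antiperiodic p f = ∀ v → f (v ℕ.+ p) ≡ - f v

  module _ {f : ℕ → ℚ} where

    periodic-* : ∀ {p} → Periodic p f → ∀ q → Periodic (q ℕ.* p) f
    periodic-* {p} per zero    v = cong f (ℕ.+-identityʳ v)
    periodic-* {p} per (suc q) v = begin
      f (v ℕ.+ (p ℕ.+ q ℕ.* p))   ≡⟨ cong f (ℕ.+-assoc v p (q ℕ.* p)) ⟨
      f (v ℕ.+ p ℕ.+ q ℕ.* p)     ≡⟨ periodic-* per q (v ℕ.+ p) ⟩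
      f (v ℕ.+ p)                 ≡⟨ per v ⟩
      f v                         ∎

    antiperiodic-odd* : ∀ {c} → Antiperiodic c f → ∀ o → parity o ≡ 1ℙ → Antiperiodic (o ℕ.* c) f
    antiperiodic-odd* {c} anti (suc zero)      _     v = trans (cong (λ x → f (v ℕ.+ x)) (ℕ.+-identityʳ c)) (anti v)
    antiperiodic-odd* {c} anti (suc (suc o)) o-odd v = begin
      f (v ℕ.+ (c ℕ.+ (c ℕ.+ o ℕ.* c)))   ≡⟨ cong f (regroup v c (o ℕ.* c)) ⟩
      f (v ℕ.+ c ℕ.+ c ℕ.+ o ℕ.* c)       ≡⟨ antiperiodic-odd* anti o o-odd (v ℕ.+ c ℕ.+ c) ⟩
      - f (v ℕ.+ c ℕ.+ c)                 ≡⟨ cong -_ (anti (v ℕ.+ c)) ⟩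
      - - f (v ℕ.+ c)                     ≡⟨ ⁻¹-involutive (f (v ℕ.+ c)) ⟩
      f (v ℕ.+ c)                         ≡⟨ anti v ⟩
      - f v                               ∎
      where
      regroup : ∀ v c x → v ℕ.+ (c ℕ.+ (c ℕ.+ x)) ≡ v ℕ.+ c ℕ.+ c ℕ.+ x
      regroup = solve-∀

    periodic∧antiperiodic⇒0 : ∀ {p c} → Periodic p f → Antiperiodic c f →
      ∀ {o q} → parity o ≡ 1ℙ → o ℕ.* c ≡ q ℕ.* p → ∀ v → f v ≡ 0ℚ
    periodic∧antiperiodic⇒0 {p} {c} per anti {o} {q} o-odd oc≡qp v = ×-cancel 2 (f v) (begin
      f v + (f v + 0ℚ)    ≡⟨ cong (f v +_) (+-identityʳ (f v)) ⟩
      f v + f v           ≡⟨ cong (_+ f v) f≡-f ⟩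
      - f v + f v         ≡⟨ +-inverseˡ (f v) ⟩
      0ℚ                  ∎)
      where
      f≡-f : f v ≡ - f v
      f≡-f = begin
        f v                  ≡⟨ periodic-* per q v ⟨
        f (v ℕ.+ q ℕ.* p)    ≡⟨ cong (λ x → f (v ℕ.+ x)) oc≡qp ⟨
        f (v ℕ.+ o ℕ.* c)    ≡⟨ antiperiodic-odd* anti o o-odd v ⟩
        - f v                ∎

    periodic-gcd : ∀ {a b d} → Periodic a f → Periodic b f → GCD a b d → Periodic d f
    periodic-gcd {a} {b} {d} per-a per-b gcd v with Bézout.identity gcd
    ... | Bézout.+- x y d+yb≡xa = begin
      f (v ℕ.+ d)               ≡⟨ periodic-* per-b y (v ℕ.+ d) ⟨
      f (v ℕ.+ d ℕ.+ y ℕ.* b)   ≡⟨ cong f (trans (ℕ.+-assoc v d (y ℕ.* b)) (cong (v ℕ.+_) d+yb≡xa)) ⟩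
      f (v ℕ.+ x ℕ.* a)         ≡⟨ periodic-* per-a x v ⟩
      f v                       ∎
    ... | Bézout.-+ x y d+xa≡yb = begin
      f (v ℕ.+ d)               ≡⟨ periodic-* per-a x (v ℕ.+ d) ⟨
      f (v ℕ.+ d ℕ.+ x ℕ.* a)   ≡⟨ cong f (trans (ℕ.+-assoc v d (x ℕ.* a)) (cong (v ℕ.+_) d+xa≡yb)) ⟩
      f (v ℕ.+ y ℕ.* b)         ≡⟨ periodic-* per-b y v ⟩
      f v                       ∎

    2-periodic-odd : Periodic 2 f → ∀ o → parity o ≡ 1ℙ → ∀ v → f (v ℕ.+ o) ≡ f (v ℕ.+ 1)
    2-periodic-odd per (suc zero)      _     v = refl
    2-periodic-odd per (suc (suc o)) o-odd v =
      trans (cong f (regroup v o)) (trans (per (v ℕ.+ o)) (2-periodic-odd per o o-odd v))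
      where
      regroup : ∀ v o → v ℕ.+ suc (suc o) ≡ v ℕ.+ o ℕ.+ 2
      regroup = solve-∀

    affine⇒periodic : ∀ {P a s} → Periodic P f → a ℕ.+ s ≡ P → (∀ v → f (v ℕ.+ s) + f (v ℕ.+ a) ≡ f v + f v) →
      ∀ o .{{_ : NonZero o}} {q} → o ℕ.* s ≡ q ℕ.* P → Periodic s f
    affine⇒periodic {P} {a} {s} per a+s≡P affine o {q} os≡qP v = x∙y⁻¹≈ε⇒x≈y (f (v ℕ.+ s)) (f v) (step≡0 v)
      where
      step : ℕ → ℚ
      step v = f (v ℕ.+ s) - f v
      step-periodic : Periodic s step
      step-periodic v = begin
        f (v ℕ.+ s ℕ.+ s) - f (v ℕ.+ s)
          ≡⟨ add-both (f (v ℕ.+ s ℕ.+ s)) (f (v ℕ.+ s)) (f v) ⟩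
        (f (v ℕ.+ s ℕ.+ s) + f v) - (f (v ℕ.+ s) + f v)
          ≡⟨ cong (λ x → (f (v ℕ.+ s ℕ.+ s) + x) - (f (v ℕ.+ s) + f v)) back ⟨
        (f (v ℕ.+ s ℕ.+ s) + f (v ℕ.+ s ℕ.+ a)) - (f (v ℕ.+ s) + f v)
          ≡⟨ cong (_- (f (v ℕ.+ s) + f v)) (affine (v ℕ.+ s)) ⟩
        (f (v ℕ.+ s) + f (v ℕ.+ s)) - (f (v ℕ.+ s) + f v)
          ≡⟨ add-bothˡ (f (v ℕ.+ s)) (f v) (f (v ℕ.+ s)) ⟨
        f (v ℕ.+ s) - f v ∎
        where
        add-both : ∀ x y z → x - y ≡ (x + z) - (y + z)
        add-both = RingSolver.solve-∀ ℚ-ring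
        add-bothˡ : ∀ x y z → x - y ≡ (z + x) - (z + y)
        add-bothˡ = RingSolver.solve-∀ ℚ-ring
        back : f (v ℕ.+ s ℕ.+ a) ≡ f v
        back = trans (cong f (trans (ℕ.+-assoc v s a) (cong (v ℕ.+_) (trans (ℕ.+-comm s a) a+s≡P)))) (per v)
      linear : ∀ t v → f (v ℕ.+ t ℕ.* s) ≡ f v + t × step v
      linear zero    v = trans (cong f (ℕ.+-identityʳ v)) (sym (+-identityʳ (f v)))
      linear (suc t) v = begin
        f (v ℕ.+ (s ℕ.+ t ℕ.* s))          ≡⟨ cong f (ℕ.+-assoc v s (t ℕ.* s)) ⟨
        f (v ℕ.+ s ℕ.+ t ℕ.* s)            ≡⟨ linear t (v ℕ.+ s) ⟩
        f (v ℕ.+ s) + t × step (v ℕ.+ s)   ≡⟨ cong (λ x → f (v ℕ.+ s) + t × x) (step-periodic v) ⟩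
        f (v ℕ.+ s) + t × step v           ≡⟨ regroup (f (v ℕ.+ s)) (f v) (t × step v) ⟩
        f v + (step v + t × step v)        ∎
        where
        regroup : ∀ x y z → x + z ≡ y + ((x - y) + z)
        regroup = RingSolver.solve-∀ ℚ-ring
      step≡0 : ∀ v → step v ≡ 0ℚ
      step≡0 v = ×-cancel o (step v) (∙-cancelˡ (f v) (o × step v) 0ℚ (begin
        f v + o × step v     ≡⟨ linear o v ⟨
        f (v ℕ.+ o ℕ.* s)    ≡⟨ cong (λ x → f (v ℕ.+ x)) os≡qP ⟩
        f (v ℕ.+ q ℕ.* P)    ≡⟨ periodic-* per q v ⟩
        f v                  ≡⟨ +-identityʳ (f v) ⟨
        f v + 0ℚ             ∎))

  sign : ℕ → ℚ
  sign v = byParity 1ℚ (- 1ℚ) (parity v)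

  sign-suc : ∀ v → sign (suc v) ≡ - sign v
  sign-suc v = trans (cong (byParity 1ℚ (- 1ℚ)) (sym (ℙ.⁻¹-selfInverse (ℙ.suc-homo-⁻¹ v)))) (flip (parity v))
    where
    flip : ∀ p → byParity 1ℚ (- 1ℚ) (p ℙ.⁻¹) ≡ - byParity 1ℚ (- 1ℚ) p
    flip 0ℙ = refl
    flip 1ℙ = refl

  antiperiodic-1⇒≡sign* : ∀ {f} → Antiperiodic 1 f → ∀ v → f v ≡ sign v * f 0
  antiperiodic-1⇒≡sign* {f} anti zero    = sym (*-identityˡ (f 0))
  antiperiodic-1⇒≡sign* {f} anti (suc v) = begin
    f (suc v)             ≡⟨ cong f (ℕ.+-comm 1 v) ⟩
    f (v ℕ.+ 1)           ≡⟨ anti v ⟩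
    - f v                 ≡⟨ cong -_ (antiperiodic-1⇒≡sign* anti v) ⟩
    - (sign v * f 0)      ≡⟨ neg-distribˡ-* (sign v) (f 0) ⟩
    - sign v * f 0        ≡⟨ cong (_* f 0) (sign-suc v) ⟨
    sign (suc v) * f 0    ∎

module NutCirculant (k : ℕ) {{_ : NonZero k}} (k-odd : parity k ≡ 1ℙ)
                    {s : ℕ} (gcd[s,m]≡2 : GCD s (k ℕ.+ k) 2) (0<s : 0 < s) (s<m : s < k ℕ.+ k) where

  open Congruence
  open TwoLayerGraph using (byParity)
  open CirculantKernel
  open PeriodicFunctions
  open Interleaving k k-odd using (m; n; m-nonZero; n-nonZero; m-even; n-even)
  import Data.Nat.Properties as ℕ
  open import Algebra.Properties.CommutativeSemigroup ℕ.+-commutativeSemigroup using (xy∙z≈xz∙y)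
  open import Data.Nat.Base using (_∸_; _≤_; >-nonZero⁻¹)
  open import Data.Nat.DivMod using (_mod_; [m+n]%n≡m%n)
  open import Data.Nat.Divisibility using (quotient; m∣n⇒n≡quotient*m)
  open import Data.Nat.GCD using (module GCD)
  open import Data.Nat.Tactic.RingSolver using (solve-∀)
  open import Data.Parity.Base as ℙ using (Parity; 0ℙ)
  import Data.Parity.Properties as ℙ
  open import Data.Fin.Base using (Fin; toℕ)
  open import Data.Fin.Properties using (toℕ-injective)
  open import Data.List.Base using (_∷_; [])
  open import Data.List.Relation.Unary.All using ([]; _∷_)
  open import Data.List.Relation.Unary.AllPairs using ([]; _∷_)
  open import Data.List.Relation.Unary.Unique.Propositional using (Unique)
  open import Data.Product.Base using (∃; _,_)
  open import Data.Rational.Base using (ℚ; 0ℚ; 1ℚ; _+_; _-_; -_; _*_)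
  open import Data.Rational.Properties using (+-0-group; +-comm; +-identityˡ; *-comm)
  open import Algebra.Properties.Group +-0-group using (inverseˡ-unique; inverseʳ-unique; x∙y⁻¹≈ε⇒x≈y)
  import Tactic.RingSolver as RingSolver
  open import Relation.Binary.PropositionalEquality
  open ≡-Reasoning

  a b : ℕ
  a = n ∸ s
  b = n ∸ k

  h : ℕ
  h = quotient (GCD.gcd∣m gcd[s,m]≡2)

  s≡h*2 : s ≡ h ℕ.* 2
  s≡h*2 = m∣n⇒n≡quotient*m (GCD.gcd∣m gcd[s,m]≡2)

  s-even : parity s ≡ 0ℙ
  s-even = trans (cong parity s≡h*2) (trans (ℙ.*-homo-* h 2) (ℙ.*-zeroʳ (parity h)))

  m≤n : m ≤ n
  m≤n = ℕ.m≤m+n m (m ℕ.+ 0)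

  s≤n : s ≤ n
  s≤n = ℕ.≤-trans (ℕ.<⇒≤ s<m) m≤n

  k<m : k < m
  k<m = ℕ.m<m+n k (>-nonZero⁻¹ k)

  k≤n : k ≤ n
  k≤n = ℕ.≤-trans (ℕ.<⇒≤ k<m) m≤n

  a+s≡n : a ℕ.+ s ≡ n
  a+s≡n = ℕ.m∸n+n≡m s≤n

  b≡k+m : b ≡ k ℕ.+ m
  b≡k+m = trans (cong (_∸ k) (n≡k+[k+m] k)) (ℕ.m+n∸m≡n k (k ℕ.+ m))
    where
    n≡k+[k+m] : ∀ k → 2 ℕ.* (k ℕ.+ k) ≡ k ℕ.+ (k ℕ.+ (k ℕ.+ k))
    n≡k+[k+m] = solve-∀

  a-even : parity a ≡ 0ℙ
  a-even = ℙ.+-cancelʳ-≡ (parity s) (parity a) 0ℙ (begin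
    parity a ℙ.+ parity s   ≡⟨ ℙ.+-homo-+ a s ⟨
    parity (a ℕ.+ s)        ≡⟨ cong parity a+s≡n ⟩
    parity n                ≡⟨ n-even ⟩
    0ℙ                      ≡⟨ cong (0ℙ ℙ.+_) s-even ⟨
    0ℙ ℙ.+ parity s         ∎)

  b-odd : parity b ≡ 1ℙ
  b-odd = trans (cong parity b≡k+m) (trans (ℙ.+-homo-+ k m) (cong₂ ℙ._+_ k-odd m-even))

  a<n : a < n
  a<n = ℕ.∸-monoʳ-< 0<s s≤n

  b<n : b < n
  b<n = ℕ.∸-monoʳ-< (>-nonZero⁻¹ k) k≤n

  s<n : s < n
  s<n = ℕ.<-≤-trans s<m m≤n

  k<n : k < n
  k<n = ℕ.<-≤-trans k<m m≤n

  parity-≢ : ∀ {x y} → parity x ≡ 0ℙ → parity y ≡ 1ℙ → x ≢ y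
  parity-≢ x-even y-odd refl with trans (sym x-even) y-odd
  ... | ()

  s≢a : s ≢ a
  s≢a s≡a = ℕ.<-irrefl (trans (cong (s ℕ.+_) s≡a) (trans (ℕ.+-comm s a) a+s≡n))
                       (ℕ.<-≤-trans (ℕ.+-mono-< s<m s<m) (ℕ.≤-reflexive (cong (m ℕ.+_) (sym (ℕ.+-identityʳ m)))))

  k≢b : k ≢ b
  k≢b k≡b = ℕ.<-irrefl (trans k≡b b≡k+m) (ℕ.m<m+n k (>-nonZero⁻¹ m))

  neighbours-unique : ∀ (u : Fin n) → Unique (neighbours u (s ∷ k ∷ []))
  neighbours-unique u =
      (distinct s<n a<n s≢a ∷ distinct s<n k<n (parity-≢ s-even k-odd)
                            ∷ distinct s<n b<n (parity-≢ s-even b-odd) ∷ [])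
    ∷ (distinct a<n k<n (parity-≢ a-even k-odd) ∷ distinct a<n b<n (parity-≢ a-even b-odd) ∷ [])
    ∷ (distinct k<n b<n k≢b ∷ [])
    ∷ []
    ∷ []
    where
    distinct : ∀ {o o'} → o < n → o' < n → o ≢ o' → u ⊕ o ≢ u ⊕ o'
    distinct o<n o'<n o≢o' eq = o≢o' (⊕-injective u o<n o'<n eq)

  G : Graph n
  G = Circ n (s ∷ k ∷ [])

  kernel-sum : ∀ y u → ∑ (λ w → adjMat G u w * y w) ≡ y (u ⊕ s) + (y (u ⊕ a) + (y (u ⊕ k) + (y (u ⊕ b) + 0ℚ)))
  kernel-sum y u = ∑-adjMat-Circ (s ∷ k ∷ []) (s≤n ∷ k≤n ∷ []) u (neighbours-unique u) y

  alternating : Fin n → ℚ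
  alternating u = sign (toℕ u)

  alternating-kernel : InKernel G alternating
  alternating-kernel u = begin
    ∑ (λ w → adjMat G u w * alternating w)
      ≡⟨ kernel-sum alternating u ⟩
    alternating (u ⊕ s) + (alternating (u ⊕ a) + (alternating (u ⊕ k) + (alternating (u ⊕ b) + 0ℚ)))
      ≡⟨ cong₂ _+_ (shift s s-even) (cong₂ _+_ (shift a a-even)
                   (cong₂ _+_ (shift k k-odd) (cong (_+ 0ℚ) (shift b b-odd)))) ⟩
    ± (p ℙ.+ 0ℙ) + (± (p ℙ.+ 0ℙ) + (± (p ℙ.+ 1ℙ) + (± (p ℙ.+ 1ℙ) + 0ℚ)))
      ≡⟨ cancel p ⟩
    0ℚ ∎
    where
    ± : Parity → ℚ
    ± = byParity 1ℚ (- 1ℚ)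
    p : Parity
    p = parity (toℕ u)
    shift : ∀ o {q} → parity o ≡ q → alternating (u ⊕ o) ≡ ± (p ℙ.+ q)
    shift o refl = cong ± (trans (cong parity (toℕ-mod (toℕ u ℕ.+ o) n))
                                 (trans (parity-% n n-even (toℕ u ℕ.+ o)) (ℙ.+-homo-+ (toℕ u) o)))
    cancel : ∀ p → ± (p ℙ.+ 0ℙ) + (± (p ℙ.+ 0ℙ) + (± (p ℙ.+ 1ℙ) + (± (p ℙ.+ 1ℙ) + 0ℚ))) ≡ 0ℚ
    cancel 0ℙ = refl
    cancel 1ℙ = refl

  alternating-nonzero : ∀ u → alternating u ≢ 0ℚ
  alternating-nonzero u with parity (toℕ u)
  ... | 0ℙ = λ ()
  ... | 1ℙ = λ ()

  -- a and b stand for −s and −k modulo n.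
  Equation : (ℕ → ℚ) → Set
  Equation Y = ∀ v → Y (v ℕ.+ s) + (Y (v ℕ.+ a) + (Y (v ℕ.+ k) + (Y (v ℕ.+ b) + 0ℚ))) ≡ 0ℚ

  v+s+a≡v+n : ∀ v → v ℕ.+ s ℕ.+ a ≡ v ℕ.+ n
  v+s+a≡v+n v = trans (ℕ.+-assoc v s a) (cong (v ℕ.+_) (trans (ℕ.+-comm s a) a+s≡n))

  module Solution {Y : ℕ → ℚ} (Y-periodic : Periodic n Y) (equation : Equation Y) where

    diff-m : ℕ → ℚ
    diff-m v = Y v - Y (v ℕ.+ m)

    diff-m-periodic : Periodic n diff-m
    diff-m-periodic v = cong₂ _-_ (Y-periodic v) (trans (cong Y (xy∙z≈xz∙y v n m)) (Y-periodic (v ℕ.+ m)))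

    equation-+m : ∀ v → Y (v ℕ.+ s ℕ.+ m) + (Y (v ℕ.+ a ℕ.+ m) + (Y (v ℕ.+ b) + (Y (v ℕ.+ k) + 0ℚ))) ≡ 0ℚ
    equation-+m v = begin
      Y (v ℕ.+ s ℕ.+ m) + (Y (v ℕ.+ a ℕ.+ m) + (Y (v ℕ.+ b) + (Y (v ℕ.+ k) + 0ℚ)))
        ≡⟨ cong₂ _+_ (cong Y (xy∙z≈xz∙y v s m)) (cong₂ _+_ (cong Y (xy∙z≈xz∙y v a m))
                     (cong₂ _+_ (cong Y v+b≡v+m+k) (cong (_+ 0ℚ) (sym Y[v+m+b]≡Y[v+k])))) ⟩
      Y (v ℕ.+ m ℕ.+ s) + (Y (v ℕ.+ m ℕ.+ a) + (Y (v ℕ.+ m ℕ.+ k) + (Y (v ℕ.+ m ℕ.+ b) + 0ℚ)))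
        ≡⟨ equation (v ℕ.+ m) ⟩
      0ℚ ∎
      where
      v+b≡v+m+k : v ℕ.+ b ≡ v ℕ.+ m ℕ.+ k
      v+b≡v+m+k = trans (cong (v ℕ.+_) (trans b≡k+m (ℕ.+-comm k m))) (sym (ℕ.+-assoc v m k))
      v+m+[k+m]≡v+k+n : ∀ v k → v ℕ.+ (k ℕ.+ k) ℕ.+ (k ℕ.+ (k ℕ.+ k)) ≡ v ℕ.+ k ℕ.+ 2 ℕ.* (k ℕ.+ k)
      v+m+[k+m]≡v+k+n = solve-∀
      Y[v+m+b]≡Y[v+k] : Y (v ℕ.+ m ℕ.+ b) ≡ Y (v ℕ.+ k)
      Y[v+m+b]≡Y[v+k] =
        trans (cong Y (trans (cong (v ℕ.+ m ℕ.+_) b≡k+m) (v+m+[k+m]≡v+k+n v k))) (Y-periodic (v ℕ.+ k))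

    diff-m-equation : ∀ v → diff-m (v ℕ.+ s) + diff-m (v ℕ.+ a) ≡ 0ℚ
    diff-m-equation v =
      trans (regroup (Y (v ℕ.+ s)) (Y (v ℕ.+ s ℕ.+ m)) (Y (v ℕ.+ a)) (Y (v ℕ.+ a ℕ.+ m)) (Y (v ℕ.+ k)) (Y (v ℕ.+ b)))
            (cong₂ _-_ (equation v) (equation-+m v))
      where
      regroup : ∀ A A' B B' C D → (A - A') + (B - B') ≡ (A + (B + (C + (D + 0ℚ)))) - (A' + (B' + (D + (C + 0ℚ))))
      regroup = RingSolver.solve-∀ ℚ-ring

    diff-m-antiperiodic : Antiperiodic (s ℕ.+ s) diff-m
    diff-m-antiperiodic v = begin
      diff-m (v ℕ.+ (s ℕ.+ s))    ≡⟨ cong diff-m (ℕ.+-assoc v s s) ⟨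
      diff-m (v ℕ.+ s ℕ.+ s)      ≡⟨ inverseˡ-unique _ _ (diff-m-equation (v ℕ.+ s)) ⟩
      - diff-m (v ℕ.+ s ℕ.+ a)    ≡⟨ cong (λ x → - diff-m x) (v+s+a≡v+n v) ⟩
      - diff-m (v ℕ.+ n)          ≡⟨ cong -_ (diff-m-periodic v) ⟩
      - diff-m v                  ∎

    m-periodic : Periodic m Y
    m-periodic v = sym (x∙y⁻¹≈ε⇒x≈y (Y v) (Y (v ℕ.+ m))
      (periodic∧antiperiodic⇒0 diff-m-periodic diff-m-antiperiodic {k} {h} k-odd k[s+s]≡h*n v))
      where
      k[x*2+x*2]≡x*[2*[k+k]] : ∀ k x → k ℕ.* (x ℕ.* 2 ℕ.+ x ℕ.* 2) ≡ x ℕ.* (2 ℕ.* (k ℕ.+ k))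
      k[x*2+x*2]≡x*[2*[k+k]] = solve-∀
      k[s+s]≡h*n : k ℕ.* (s ℕ.+ s) ≡ h ℕ.* n
      k[s+s]≡h*n = trans (cong (λ x → k ℕ.* (x ℕ.+ x)) s≡h*2) (k[x*2+x*2]≡x*[2*[k+k]] k h)

    Y[v+k+k]≡Y[v] : ∀ v → Y (v ℕ.+ k ℕ.+ k) ≡ Y v
    Y[v+k+k]≡Y[v] v = trans (cong Y (ℕ.+-assoc v k k)) (m-periodic v)

    equation′ : ∀ v → Y (v ℕ.+ s) + (Y (v ℕ.+ a) + (Y (v ℕ.+ k) + (Y (v ℕ.+ k) + 0ℚ))) ≡ 0ℚ
    equation′ v = trans (cong (λ x → Y (v ℕ.+ s) + (Y (v ℕ.+ a) + (Y (v ℕ.+ k) + (x + 0ℚ)))) (sym Y[v+b]≡Y[v+k]))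
                        (equation v)
      where
      Y[v+b]≡Y[v+k] : Y (v ℕ.+ b) ≡ Y (v ℕ.+ k)
      Y[v+b]≡Y[v+k] = trans (cong Y (trans (cong (v ℕ.+_) b≡k+m) (sym (ℕ.+-assoc v k m)))) (m-periodic (v ℕ.+ k))

    sum-k : ℕ → ℚ
    sum-k v = Y v + Y (v ℕ.+ k)

    sum-k-k-periodic : Periodic k sum-k
    sum-k-k-periodic v = trans (cong (Y (v ℕ.+ k) +_) (Y[v+k+k]≡Y[v] v)) (+-comm (Y (v ℕ.+ k)) (Y v))

    sum-k-n-periodic : Periodic n sum-k
    sum-k-n-periodic v = cong₂ _+_ (Y-periodic v) (trans (cong Y (xy∙z≈xz∙y v n k)) (Y-periodic (v ℕ.+ k)))

    sum-k-equation : ∀ v → sum-k v + sum-k (v ℕ.+ s) + (sum-k (v ℕ.+ a) + sum-k v) ≡ 0ℚ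
    sum-k-equation v =
      trans (regroup (Y v) (Y (v ℕ.+ k)) (Y (v ℕ.+ s)) (Y (v ℕ.+ s ℕ.+ k)) (Y (v ℕ.+ a)) (Y (v ℕ.+ a ℕ.+ k)))
            (trans (cong₂ _+_ (equation′ v) equation′-+k) (+-identityˡ 0ℚ))
      where
      regroup : ∀ Z C A A' B B' →
        (Z + C) + (A + A') + ((B + B') + (Z + C)) ≡ (A + (B + (C + (C + 0ℚ)))) + (A' + (B' + (Z + (Z + 0ℚ))))
      regroup = RingSolver.solve-∀ ℚ-ring
      equation′-+k : Y (v ℕ.+ s ℕ.+ k) + (Y (v ℕ.+ a ℕ.+ k) + (Y v + (Y v + 0ℚ))) ≡ 0ℚ
      equation′-+k = trans (cong₂ _+_ (cong Y (xy∙z≈xz∙y v s k)) (cong₂ _+_ (cong Y (xy∙z≈xz∙y v a k))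
                       (cong₂ _+_ (sym (Y[v+k+k]≡Y[v] v)) (cong (_+ 0ℚ) (sym (Y[v+k+k]≡Y[v] v))))))
                     (equation′ (v ℕ.+ k))

    sum-k-s : ℕ → ℚ
    sum-k-s v = sum-k v + sum-k (v ℕ.+ s)

    sum-k-s-k-periodic : Periodic k sum-k-s
    sum-k-s-k-periodic v =
      cong₂ _+_ (sum-k-k-periodic v) (trans (cong sum-k (xy∙z≈xz∙y v k s)) (sum-k-k-periodic (v ℕ.+ s)))

    sum-k-s-antiperiodic : Antiperiodic a sum-k-s
    sum-k-s-antiperiodic v = inverseʳ-unique (sum-k-s v) (sum-k-s (v ℕ.+ a)) (begin
      sum-k-s v + (sum-k (v ℕ.+ a) + sum-k (v ℕ.+ a ℕ.+ s))
        ≡⟨ cong (λ x → sum-k-s v + (sum-k (v ℕ.+ a) + x)) (trans (cong sum-k (v+a+s≡v+n v)) (sum-k-n-periodic v)) ⟩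
      sum-k-s v + (sum-k (v ℕ.+ a) + sum-k v)
        ≡⟨ sum-k-equation v ⟩
      0ℚ ∎)
      where
      v+a+s≡v+n : ∀ v → v ℕ.+ a ℕ.+ s ≡ v ℕ.+ n
      v+a+s≡v+n v = trans (ℕ.+-assoc v a s) (cong (v ℕ.+_) a+s≡n)

    sum-k-antiperiodic : Antiperiodic s sum-k
    sum-k-antiperiodic v = inverseʳ-unique (sum-k v) (sum-k (v ℕ.+ s))
      (periodic∧antiperiodic⇒0 sum-k-s-k-periodic sum-k-s-antiperiodic {k} {a} k-odd (ℕ.*-comm k a) v)

    k-antiperiodic : Antiperiodic k Y
    k-antiperiodic v = inverseʳ-unique (Y v) (Y (v ℕ.+ k))
      (periodic∧antiperiodic⇒0 sum-k-k-periodic sum-k-antiperiodic {k} {s} k-odd (ℕ.*-comm k s) v)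

    s-periodic : Periodic s Y
    s-periodic = affine⇒periodic Y-periodic a+s≡n affine m {h} m*s≡h*n
      where
      affine : ∀ v → Y (v ℕ.+ s) + Y (v ℕ.+ a) ≡ Y v + Y v
      affine v = begin
        Y (v ℕ.+ s) + Y (v ℕ.+ a)
          ≡⟨ regroup (Y (v ℕ.+ s)) (Y (v ℕ.+ a)) (Y v) ⟩
        Y (v ℕ.+ s) + (Y (v ℕ.+ a) + (- Y v + (- Y v + 0ℚ))) + (Y v + Y v)
          ≡⟨ cong (λ x → Y (v ℕ.+ s) + (Y (v ℕ.+ a) + (x + (x + 0ℚ))) + (Y v + Y v)) (sym (k-antiperiodic v)) ⟩
        Y (v ℕ.+ s) + (Y (v ℕ.+ a) + (Y (v ℕ.+ k) + (Y (v ℕ.+ k) + 0ℚ))) + (Y v + Y v)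
          ≡⟨ cong (_+ (Y v + Y v)) (equation′ v) ⟩
        0ℚ + (Y v + Y v)
          ≡⟨ +-identityˡ (Y v + Y v) ⟩
        Y v + Y v ∎
        where
        regroup : ∀ A B Z → A + B ≡ A + (B + (- Z + (- Z + 0ℚ))) + (Z + Z)
        regroup = RingSolver.solve-∀ ℚ-ring
      m*s≡h*n : m ℕ.* s ≡ h ℕ.* n
      m*s≡h*n = trans (cong (m ℕ.*_) s≡h*2) ([k+k]*[x*2]≡x*[2*[k+k]] k h)
        where
        [k+k]*[x*2]≡x*[2*[k+k]] : ∀ k x → (k ℕ.+ k) ℕ.* (x ℕ.* 2) ≡ x ℕ.* (2 ℕ.* (k ℕ.+ k))
        [k+k]*[x*2]≡x*[2*[k+k]] = solve-∀

    1-antiperiodic : Antiperiodic 1 Y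
    1-antiperiodic v = begin
      Y (v ℕ.+ 1)   ≡⟨ 2-periodic-odd (periodic-gcd s-periodic m-periodic gcd[s,m]≡2) k k-odd v ⟨
      Y (v ℕ.+ k)   ≡⟨ k-antiperiodic v ⟩
      - Y v         ∎

  kernel-unique : ∀ y → InKernel G y → ∃ λ c → ∀ u → y u ≡ c * alternating u
  kernel-unique y y-kernel = Y 0 , λ u → begin
    y u                            ≡⟨ cong y (toℕ-mod-inverse u) ⟨
    Y (toℕ u)                      ≡⟨ antiperiodic-1⇒≡sign* (Solution.1-antiperiodic Y-periodic equation) (toℕ u) ⟩
    sign (toℕ u) * Y 0             ≡⟨ *-comm (sign (toℕ u)) (Y 0) ⟩
    Y 0 * alternating u            ∎
    where
    Y : ℕ → ℚ
    Y v = y (v mod n)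
    Y-periodic : Periodic n Y
    Y-periodic v = cong y (toℕ-injective (trans (toℕ-mod (v ℕ.+ n) n) (trans ([m+n]%n≡m%n v n) (sym (toℕ-mod v n)))))
    equation : Equation Y
    equation v = trans (sym (cong₂ _+_ (cong y (mod-⊕ v s)) (cong₂ _+_ (cong y (mod-⊕ v a))
                   (cong₂ _+_ (cong y (mod-⊕ v k)) (cong (_+ 0ℚ) (cong y (mod-⊕ v b)))))))
                 (trans (sym (kernel-sum y (v mod n))) (y-kernel (v mod n)))

  isNut : IsNut G
  isNut = alternating , alternating-kernel , alternating-nonzero , kernel-unique

open import Data.Nat.Base using (zero; suc; _+_; _*_; _∸_; _≤_; s≤s; z≤n)
open import Data.Nat.Properties using (≤-trans; m≤m+n)
open import Data.Nat.DivMod using (_/_; _%_; m≡m%n+[m/n]*n)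
open import Data.Nat.Divisibility using (_∣_; divides; ∣-refl; ∣m+n∣m⇒∣n; ∣n⇒∣m*n)
open import Data.Nat.GCD using (module GCD)
open import Data.Nat.Tactic.RingSolver using (solve-∀)
open import Data.Parity.Base as ℙ using (0ℙ)
import Data.Parity.Properties as ℙ
open import Data.List.Base using (_∷_; [])
open import Data.Product.Base using (_×_; _,_; ∃; proj₁)
open import Relation.Binary.PropositionalEquality using (refl; sym; trans; cong; subst; module ≡-Reasoning)
open ≡-Reasoning

parity-odd : ∀ j → parity (suc (j + j)) ≡ 1ℙ
parity-odd j = sym (ℙ.⁻¹-selfInverse (begin
  parity (suc (j + j)) ℙ.⁻¹   ≡⟨ ℙ.suc-homo-⁻¹ (j + j) ⟩
  parity (j + j)              ≡⟨ ℙ.+-homo-+ j j ⟩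
  parity j ℙ.+ parity j       ≡⟨ ℙ.p+p≡0ℙ (parity j) ⟩
  0ℙ                          ∎))

2∣k+k : ∀ k → 2 ∣ k + k
2∣k+k k = divides k (k+k≡k*2 k)
  where
  k+k≡k*2 : ∀ k → k + k ≡ k * 2
  k+k≡k*2 = solve-∀

gcd[2,k+k]≡2 : ∀ k → GCD 2 (k + k) 2
gcd[2,k+k]≡2 k = GCD.is (∣-refl , 2∣k+k k) proj₁

gcd[4,k+k]≡2 : ∀ j → GCD 4 (suc (j + j) + suc (j + j)) 2
gcd[4,k+k]≡2 j = GCD.is (divides 2 refl , 2∣k+k (suc (j + j)))
  λ {c} (c∣4 , c∣k+k) → ∣m+n∣m⇒∣n (subst (c ∣_) (k+k≡j*4+2 j) c∣k+k) (∣n⇒∣m*n j c∣4)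
  where
  k+k≡j*4+2 : ∀ j → suc (j + j) + suc (j + j) ≡ j * 4 + 2
  k+k≡j*4+2 = solve-∀

m%4≡2⇒m≡k+k : ∀ {m} → 6 ≤ m → m % 4 ≡ 2 → ∃ λ i → m ≡ suc (suc i + suc i) + suc (suc i + suc i)
m%4≡2⇒m≡k+k {m} 6≤m m%4≡2 with m / 4 | m≡m%n+[m/n]*n m 4
... | zero  | m≡m%4+0 with subst (6 ≤_) (trans m≡m%4+0 (cong (_+ 0) m%4≡2)) 6≤m
...   | s≤s (s≤s ())
m%4≡2⇒m≡k+k {m} 6≤m m%4≡2 | suc i | m≡m%4+[1+i]*4 = i , (begin
  m                                        ≡⟨ m≡m%4+[1+i]*4 ⟩
  m % 4 + suc i * 4                        ≡⟨ cong (_+ suc i * 4) m%4≡2 ⟩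
  2 + suc i * 4                            ≡⟨ 2+[1+i]*4≡k+k i ⟩
  suc (suc i + suc i) + suc (suc i + suc i) ∎)
  where
  2+[1+i]*4≡k+k : ∀ i → 2 + suc i * 4 ≡ suc (suc i + suc i) + suc (suc i + suc i)
  2+[1+i]*4≡k+k = solve-∀

proposition6p1 : ∀ (m : ℕ) → 6 ≤ m → m % 4 ≡ 2 →
    ((B₂ m 2 2 (m / 2) ≅ Circ (2 * m) (4 ∷ m / 2 ∷ []))
      × (B₁ m 2 2 ≅ Circ (2 * m) (4 ∷ m / 2 ∷ []))
      × IsNut (Circ (2 * m) (4 ∷ m / 2 ∷ [])))
    × ((B₂ m 1 1 (m / 2) ≅ Circ (2 * m) (2 ∷ m / 2 ∷ []))
      × (B₃ m 1 (m ∸ 1) ≅ Circ (2 * m) (2 ∷ m / 2 ∷ []))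
      × IsNut (Circ (2 * m) (2 ∷ m / 2 ∷ [])))
proposition6p1 m 6≤m m%4≡2 with m%4≡2⇒m≡k+k 6≤m m%4≡2
... | i , refl =
    (B₂≅Circ 2 , B₁≅Circ 2 refl , isNut 4 (gcd[4,k+k]≡2 j) (s≤s z≤n) (s≤s (s≤s (s≤s (s≤s (s≤s z≤n))))))
  , (B₂≅Circ 1 , B₃≅Circ 1 (k + k ∸ 1) refl refl , isNut 2 (gcd[2,k+k]≡2 k) (s≤s z≤n) (s≤s (s≤s (s≤s z≤n))))
  where
  j k : ℕ
  j = suc i
  k = suc (j + j)
  open Interleaving k (parity-odd j) using (B₁≅Circ; B₂≅Circ; B₃≅Circ; half)
  k+k≡6+i*4 : ∀ i → suc (suc i + suc i) + suc (suc i + suc i) ≡ 6 + i * 4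
  k+k≡6+i*4 = solve-∀
  isNut : ∀ s → GCD s (k + k) 2 → 0 < s → s < 6 → IsNut (Circ (2 * (k + k)) (s ∷ (k + k) / 2 ∷ []))
  isNut s gcd 0<s s<6 = subst (λ x → IsNut (Circ (2 * (k + k)) (s ∷ x ∷ []))) (sym half)
    (NutCirculant.isNut k (parity-odd j) gcd 0<s (≤-trans s<6 (subst (6 ≤_) (sym (k+k≡6+i*4 i)) (m≤m+n 6 (i * 4)))))
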